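{- Let $\mathbf m=(m_1,\dots,m_n)$ be positive integers. The number of join-irreducible elements of the combinatorial barcode lattice $\mathbf{BL}(\mathbf m)$ is \[\prod_{i=1}^n(m_i+1)-(m_1+m_2+\dots+m_n+1)-\sum_{i=1}^{n-1}\left[\left(\prod_{j=1}^{i-1}m_j\right)\left(\prod_{j=i+1}^n(m_j+1)-1\right)\right].\]
   Context: $\mathbf{BL}(\mathbf m)$ is the set of words of the multiset with $m_i$ copies of $i$ ($i\in[n]$) in which, for each $i\in[n-1]$, the first occurrence of $i$ precedes the first occurrence of $i+1$, partially ordered by the reflexive-transitive closure of the relation: $s\lessdot t$ iff $t$ arises from $s$ by swapping two adjacent entries $a<b$ that appear as $ab$ in $s$. This poset is a lattice. An element is join-irreducible if it is not the minimum and is not the join of two elements strictly below it (equivalently, it covers exactly one element). -}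

module Defs where

open import Data.Nat as ℕ using (ℕ; zero; suc)
open import Data.Fin using (Fin; toℕ; _<_; _≟_)
open import Data.List using (List; []; _∷_; _++_; take; drop; map; upTo; foldr)
open import Data.Nat.ListAction using (sum; product)
open import Data.List.Membership.Propositional using (_∈_)
open import Data.Vec using (Vec; lookup; toList)
open import Data.Integer as ℤ using (ℤ; +_)
open import Data.Product using (Σ; _×_; ∃; ∃-syntax; _,_)
open import Relation.Nullary using (¬_; yes; no)
open import Relation.Binary.PropositionalEquality using (_≡_; _≢_)
open import Relation.Binary.Construct.Closure.ReflexiveTransitive using (Star)

-- Letters are 0-indexed: letter i : Fin n stands for the paper's letter i+1.
-- m : Vec ℕ n, with (lookup m i) the number of copies of letter i.

occ : ∀ {n} → Fin n → List (Fin n) → ℕ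
occ x [] = zero
occ x (y ∷ w) with x ≟ y
... | yes _ = suc (occ x w)
... | no  _ = occ x w

Word : ℕ → Set
Word n = List (Fin n)

-- "the first occurrence of a precedes the first occurrence of b"
-- (for letters that both occur): every occurrence of b is preceded by some a
FirstBefore : ∀ {n} → Fin n → Fin n → Word n → Set
FirstBefore a b w = ∀ u v → w ≡ u ++ (b ∷ v) → a ∈ u

InBL : ∀ {n} → Vec ℕ n → Word n → Set
InBL {n} m w =
  (∀ (i : Fin n) → occ i w ≡ lookup m i) ×
  (∀ (i j : Fin n) → toℕ j ≡ suc (toℕ i) → FirstBefore i j w)

_⋖_ : ∀ {n} → Word n → Word n → Set
s ⋖ t = ∃[ u ] ∃[ v ] ∃[ a ] ∃[ b ]
  (a < b × s ≡ u ++ (a ∷ b ∷ v) × t ≡ u ++ (b ∷ a ∷ v))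

Step : ∀ {n} → Vec ℕ n → Word n → Word n → Set
Step m s t = InBL m s × InBL m t × s ⋖ t

_≤[_]_ : ∀ {n} → Word n → Vec ℕ n → Word n → Set
s ≤[ m ] t = Star (Step m) s t

_<[_]_ : ∀ {n} → Word n → Vec ℕ n → Word n → Set
s <[ m ] t = s ≤[ m ] t × s ≢ t

IsJoin : ∀ {n} → Vec ℕ n → Word n → Word n → Word n → Set
IsJoin m x y z =
  InBL m z × x ≤[ m ] z × y ≤[ m ] z ×
  (∀ u → InBL m u → x ≤[ m ] u → y ≤[ m ] u → z ≤[ m ] u)

IsMin : ∀ {n} → Vec ℕ n → Word n → Set
IsMin m t = InBL m t × (∀ u → InBL m u → t ≤[ m ] u)

JoinIrreducible : ∀ {n} → Vec ℕ n → Word n → Set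
JoinIrreducible m t =
  InBL m t × ¬ IsMin m t ×
  ¬ (∃[ x ] ∃[ y ] (InBL m x × InBL m y × x <[ m ] t × y <[ m ] t × IsJoin m x y t))

sumℤ : List ℤ → ℤ
sumℤ = foldr ℤ._+_ (+ 0)

formula : ∀ {n} → Vec ℕ n → ℤ
formula {n} m =
  (+ product (map suc ms)) ℤ.- (+ (sum ms) ℤ.+ + 1) ℤ.-
  sumℤ (map term (upTo (n ℕ.∸ 1)))
  where
  ms = toList m
  term : ℕ → ℤ
  term i = (+ product (take i ms)) ℤ.* ((+ product (map suc (drop (suc i) ms))) ℤ.- + 1)

{-# OPTIONS --safe #-}
-- Write before w x y l for the number of x's preceding the l-th y in w. For words of BL(m),
-- s ≤ t holds iff before t x y l ≤ before s x y l for all letters x < y and all l: a swap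
-- ab ↦ ba lowers exactly one of these counts, by one, and conversely a word dominated in this
-- sense is reached from below by moving letters to the front one swap at a time.
-- In this description a word with two descents is the join of the two lower covers obtained by
-- undoing them (they lower different counts), a word with no descent is the minimum, and a word
-- with one descent has a unique lower cover lying above everything below the word. So the
-- join-irreducibles are the words with exactly one descent. Splitting off the smallest letter,
-- such a word is either 1^m₁ followed by a one-descent word for (m₂, …), or 1^a A 1^(m₁-a) B
-- with 0 < a < m₁, A ≠ [] and A, B increasing words in the letters 2, 3, …. Counting these gives
-- s(m) − Σ mᵢ, where s(m) = m₁ (1 + s(m₂, …)) counts the pairs (P, Q) of increasing words with
-- P ≠ [] and PQ ∈ BL(m); this agrees with the stated formula.
module Submission where

open import Defs
open import Data.Nat as ℕ using (ℕ; zero; suc; _+_; _∸_; _≤_; z≤n; s≤s)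
import Data.Nat.Properties as ℕP
open import Data.Nat.ListAction using (sum; product)
open import Data.Nat.Solver using () renaming (module +-*-Solver to ℕSolver)
import Data.Integer as ℤ
import Data.Integer.Properties as ℤP
open import Data.Integer.Solver using () renaming (module +-*-Solver to ℤSolver)
open import Algebra.Properties.CommutativeSemigroup ℕP.+-commutativeSemigroup using (x∙yz≈y∙xz)
open import Data.Fin as Fin using (Fin; zero; suc; toℕ; _≟_)
import Data.Fin.Properties as FinP
open import Data.Vec using (Vec; []; _∷_; lookup; toList)
open import Data.List using (List; []; _∷_; [_]; _++_; map; length; replicate; take; drop; upTo; applyUpTo)
import Data.List.Properties as ListP
open import Data.List.Membership.Propositional using (_∈_)
open import Data.List.Membership.Propositional.Properties using (∈-map⁺; ∈-map⁻; ∈-++⁺ˡ; ∈-++⁺ʳ; ∈-++⁻)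
open import Data.List.Relation.Unary.Unique.Propositional using (Unique)
import Data.List.Relation.Unary.Unique.Propositional.Properties as Unique
open import Data.List.Relation.Unary.AllPairs using ([]; _∷_)
import Data.List.Relation.Unary.All as All
open import Data.List.Relation.Unary.Any using (here; there)
open import Data.Product using (_×_; ∃-syntax; _,_; proj₁; proj₂)
open import Data.Sum using (_⊎_; inj₁; inj₂)
open import Data.Empty using (⊥; ⊥-elim)
open import Data.Unit using (⊤; tt)
open import Function using (_∘_)
open import Function.Bundles using (_⇔_; mk⇔)
open import Relation.Nullary using (¬_; Dec; yes; no)
open import Relation.Nullary.Decidable using (_×-dec_)
open import Relation.Binary.PropositionalEquality
  using (_≡_; _≢_; refl; sym; trans; cong; cong₂; subst; module ≡-Reasoning)
open import Relation.Binary.Definitions using (tri<; tri≈; tri>)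
open import Relation.Binary.Construct.Closure.ReflexiveTransitive as Star
  using (Star; ε; _◅_; _◅◅_)

private
  variable
    n : ℕ

module _ {x z : Fin n} (w : Word n) where

  occ-∷-≡ : x ≡ z → occ x (z ∷ w) ≡ suc (occ x w)
  occ-∷-≡ x≡z with x ≟ z
  ... | yes _ = refl
  ... | no x≢z = ⊥-elim (x≢z x≡z)

  occ-∷-≢ : x ≢ z → occ x (z ∷ w) ≡ occ x w
  occ-∷-≢ x≢z with x ≟ z
  ... | yes x≡z = ⊥-elim (x≢z x≡z)
  ... | no _ = refl

occ-++ : ∀ (x : Fin n) (u v : Word n) → occ x (u ++ v) ≡ occ x u + occ x v
occ-++ x [] v = refl
occ-++ x (z ∷ u) v with x ≟ z
... | yes _ = cong suc (occ-++ x u v)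
... | no _ = occ-++ x u v

occ-∈ : ∀ (x : Fin n) (u v : Word n) → 1 ℕ.≤ occ x (u ++ x ∷ v)
occ-∈ x u v rewrite occ-++ x u (x ∷ v) | occ-∷-≡ v (refl {x = x}) =
  ℕP.≤-trans (s≤s z≤n) (ℕP.m≤n+m _ (occ x u))

occ-move-to-front : ∀ (y x : Fin n) (s₁ s₂ : Word n) → occ y (s₁ ++ x ∷ s₂) ≡ occ y (x ∷ s₁ ++ s₂)
occ-move-to-front y x s₁ s₂ = begin
  occ y (s₁ ++ x ∷ s₂)                    ≡⟨ occ-++ y s₁ (x ∷ s₂) ⟩
  occ y s₁ + occ y (x ∷ s₂)               ≡⟨ cong (occ y s₁ +_) (occ-++ y [ x ] s₂) ⟩
  occ y s₁ + (occ y [ x ] + occ y s₂)     ≡⟨ x∙yz≈y∙xz (occ y s₁) (occ y [ x ]) (occ y s₂) ⟩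
  occ y [ x ] + (occ y s₁ + occ y s₂)     ≡⟨ cong (occ y [ x ] +_) (occ-++ y s₁ s₂) ⟨
  occ y [ x ] + occ y (s₁ ++ s₂)          ≡⟨ occ-++ y [ x ] (s₁ ++ s₂) ⟨
  occ y (x ∷ s₁ ++ s₂)                    ∎
  where open ≡-Reasoning

occ-∷-cancel : ∀ (y x : Fin n) (s t : Word n) → occ y (x ∷ s) ≡ occ y (x ∷ t) → occ y s ≡ occ y t
occ-∷-cancel y x s t with y ≟ x
... | yes _ = ℕP.suc-injective
... | no _ = λ same → same

occ-swap : ∀ (x a b : Fin n) (u v : Word n) → occ x (u ++ a ∷ b ∷ v) ≡ occ x (u ++ b ∷ a ∷ v)
occ-swap x a b u v = begin
  occ x (u ++ a ∷ b ∷ v)       ≡⟨ occ-++ x u _ ⟩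
  occ x u + occ x (a ∷ b ∷ v)  ≡⟨ cong (occ x u +_) (occ-move-to-front x b [ a ] v) ⟩
  occ x u + occ x (b ∷ a ∷ v)  ≡⟨ occ-++ x u _ ⟨
  occ x (u ++ b ∷ a ∷ v)       ∎
  where open ≡-Reasoning

-- l is 0-based; when y occurs at most l times, all x's of w are counted.
before : Word n → Fin n → Fin n → ℕ → ℕ
before [] x y l = 0
before (z ∷ w) x y l with y ≟ z | x ≟ z
before (z ∷ w) x y zero    | yes _ | _ = 0
before (z ∷ w) x y (suc l) | yes _ | _ = before w x y l
... | no _ | yes _ = suc (before w x y l)
... | no _ | no _ = before w x y l

module _ {x y z : Fin n} (w : Word n) where

  before-∷-stop : y ≡ z → before (z ∷ w) x y 0 ≡ 0
  before-∷-stop y≡z with y ≟ z | x ≟ z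
  ... | yes _ | _ = refl
  ... | no y≢z | _ = ⊥-elim (y≢z y≡z)

  before-∷-pass : ∀ l → y ≡ z → before (z ∷ w) x y (suc l) ≡ before w x y l
  before-∷-pass l y≡z with y ≟ z | x ≟ z
  ... | yes _ | _ = refl
  ... | no y≢z | _ = ⊥-elim (y≢z y≡z)

  before-∷-count : ∀ l → y ≢ z → x ≡ z → before (z ∷ w) x y l ≡ suc (before w x y l)
  before-∷-count l y≢z x≡z with y ≟ z | x ≟ z
  ... | yes y≡z | _ = ⊥-elim (y≢z y≡z)
  ... | no _ | yes _ = refl
  ... | no _ | no x≢z = ⊥-elim (x≢z x≡z)

  before-∷-ignore : ∀ l → y ≢ z → x ≢ z → before (z ∷ w) x y l ≡ before w x y l
  before-∷-ignore l y≢z x≢z with y ≟ z | x ≟ z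
  ... | yes y≡z | _ = ⊥-elim (y≢z y≡z)
  ... | no _ | yes x≡z = ⊥-elim (x≢z x≡z)
  ... | no _ | no _ = refl

before-++-early : ∀ (x y : Fin n) (u r : Word n) l → l ℕ.< occ y u → before (u ++ r) x y l ≡ before u x y l
before-++-early x y (z ∷ u) r l l<occ with y ≟ z | x ≟ z
before-++-early x y (z ∷ u) r zero    l<occ | yes _ | _ = refl
before-++-early x y (z ∷ u) r (suc l) l<occ | yes _ | _ = before-++-early x y u r l (ℕP.≤-pred l<occ)
... | no _ | yes _ = cong suc (before-++-early x y u r l l<occ)
... | no _ | no _ = before-++-early x y u r l l<occ

before-++-late : ∀ (x y : Fin n) → x ≢ y → ∀ (u r : Word n) k →
                 before (u ++ r) x y (occ y u + k) ≡ occ x u + before r x y k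
before-++-late x y x≢y [] r k = refl
before-++-late x y x≢y (z ∷ u) r k with y ≟ z | x ≟ z
... | yes refl | yes refl = ⊥-elim (x≢y refl)
... | yes _ | no _ = before-++-late x y x≢y u r k
... | no _ | yes _ = cong suc (before-++-late x y x≢y u r k)
... | no _ | no _ = before-++-late x y x≢y u r k

before-++-absent : ∀ (x y : Fin n) → x ≢ y → ∀ (u r : Word n) l → occ y u ≡ 0 →
                   before (u ++ r) x y l ≡ occ x u + before r x y l
before-++-absent x y x≢y u r l occ≡0 =
  subst (λ k → before (u ++ r) x y (k + l) ≡ occ x u + before r x y l) occ≡0 (before-++-late x y x≢y u r l)

before≤occ : ∀ (x y : Fin n) (u : Word n) l → before u x y l ℕ.≤ occ x u
before≤occ x y [] l = z≤n
before≤occ x y (z ∷ u) l with y ≟ z | x ≟ z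
before≤occ x y (z ∷ u) zero    | yes _ | _ = z≤n
before≤occ x y (z ∷ u) (suc l) | yes _ | yes _ = ℕP.m≤n⇒m≤1+n (before≤occ x y u l)
before≤occ x y (z ∷ u) (suc l) | yes _ | no _ = before≤occ x y u l
... | no _ | yes _ = s≤s (before≤occ x y u l)
... | no _ | no _ = before≤occ x y u l

before-insert : ∀ (x y z : Fin n) → z ≢ x → z ≢ y → ∀ (u r : Word n) l →
                before (u ++ z ∷ r) x y l ≡ before (u ++ r) x y l
before-insert x y z z≢x z≢y [] r l = before-∷-ignore r l (z≢y ∘ sym) (z≢x ∘ sym)
before-insert x y z z≢x z≢y (w ∷ u) r l with y ≟ w | x ≟ w
before-insert x y z z≢x z≢y (w ∷ u) r zero    | yes _ | _ = refl
before-insert x y z z≢x z≢y (w ∷ u) r (suc l) | yes _ | _ = before-insert x y z z≢x z≢y u r l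
... | no _ | yes _ = cong suc (before-insert x y z z≢x z≢y u r l)
... | no _ | no _ = before-insert x y z z≢x z≢y u r l

before-insert-≤ : ∀ (x y z : Fin n) → z ≢ y → ∀ (u r : Word n) l →
                  before (u ++ z ∷ r) x y l ℕ.≤ suc (before (u ++ r) x y l)
before-insert-≤ x y z z≢y [] r l with y ≟ z | x ≟ z
... | yes y≡z | _ = ⊥-elim (z≢y (sym y≡z))
... | no _ | yes _ = ℕP.≤-refl
... | no _ | no _ = ℕP.n≤1+n _
before-insert-≤ x y z z≢y (w ∷ u) r l with y ≟ w | x ≟ w
before-insert-≤ x y z z≢y (w ∷ u) r zero    | yes _ | _ = z≤n
before-insert-≤ x y z z≢y (w ∷ u) r (suc l) | yes _ | _ = before-insert-≤ x y z z≢y u r l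
... | no _ | yes _ = s≤s (before-insert-≤ x y z z≢y u r l)
... | no _ | no _ = before-insert-≤ x y z z≢y u r l

module _ {a b x y : Fin n} (a<b : a Fin.< b) (x<y : x Fin.< y) where

  before-adjacent-swap : ∀ (v : Word n) k → ¬ (x ≡ a × y ≡ b × k ≡ 0) →
                         before (a ∷ b ∷ v) x y k ≡ before (b ∷ a ∷ v) x y k
  before-adjacent-swap v k exception = cases (y ≟ a) (y ≟ b) (x ≟ a) (x ≟ b) k exception
    where
    cases : Dec (y ≡ a) → Dec (y ≡ b) → Dec (x ≡ a) → Dec (x ≡ b) → ∀ k → ¬ (x ≡ a × y ≡ b × k ≡ 0) →
            before (a ∷ b ∷ v) x y k ≡ before (b ∷ a ∷ v) x y k
    cases (yes y≡a) _ _ _ zero _ =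
      trans (before-∷-stop (b ∷ v) y≡a) (sym (trans (before-∷-ignore (a ∷ v) 0 y≢b x≢b) (before-∷-stop v y≡a)))
      where
      y≢b : y ≢ b
      y≢b y≡b = FinP.<⇒≢ a<b (trans (sym y≡a) y≡b)
      x≢b : x ≢ b
      x≢b = FinP.<⇒≢ (FinP.<-trans x<y (subst (Fin._< b) (sym y≡a) a<b))
    cases (yes y≡a) _ _ _ (suc k) _ =
      trans (before-∷-pass (b ∷ v) k y≡a) (trans (before-∷-ignore v k y≢b x≢b)
        (sym (trans (before-∷-ignore (a ∷ v) (suc k) y≢b x≢b) (before-∷-pass v k y≡a))))
      where
      y≢b : y ≢ b
      y≢b y≡b = FinP.<⇒≢ a<b (trans (sym y≡a) y≡b)
      x≢b : x ≢ b
      x≢b = FinP.<⇒≢ (FinP.<-trans x<y (subst (Fin._< b) (sym y≡a) a<b))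
    cases (no y≢a) (yes y≡b) (yes x≡a) _ zero exception = ⊥-elim (exception (x≡a , y≡b , refl))
    cases (no y≢a) (yes y≡b) (yes x≡a) _ (suc k) _ =
      trans (before-∷-count (b ∷ v) (suc k) y≢a x≡a) (trans (cong suc (before-∷-pass v k y≡b))
        (sym (trans (before-∷-pass (a ∷ v) k y≡b) (before-∷-count v k y≢a x≡a))))
    cases (no y≢a) (yes y≡b) (no x≢a) _ zero _ =
      trans (before-∷-ignore (b ∷ v) 0 y≢a x≢a) (trans (before-∷-stop v y≡b) (sym (before-∷-stop (a ∷ v) y≡b)))
    cases (no y≢a) (yes y≡b) (no x≢a) _ (suc k) _ =
      trans (before-∷-ignore (b ∷ v) (suc k) y≢a x≢a) (trans (before-∷-pass v k y≡b)
        (sym (trans (before-∷-pass (a ∷ v) k y≡b) (before-∷-ignore v k y≢a x≢a))))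
    cases (no y≢a) (no y≢b) (yes x≡a) _ k _ =
      trans (before-∷-count (b ∷ v) k y≢a x≡a) (trans (cong suc (before-∷-ignore v k y≢b x≢b))
        (sym (trans (before-∷-ignore (a ∷ v) k y≢b x≢b) (before-∷-count v k y≢a x≡a))))
      where
      x≢b : x ≢ b
      x≢b x≡b = FinP.<⇒≢ a<b (trans (sym x≡a) x≡b)
    cases (no y≢a) (no y≢b) (no x≢a) (yes x≡b) k _ =
      trans (before-∷-ignore (b ∷ v) k y≢a x≢a) (trans (before-∷-count v k y≢b x≡b)
        (sym (trans (before-∷-count (a ∷ v) k y≢b x≡b) (cong suc (before-∷-ignore v k y≢a x≢a)))))
    cases (no y≢a) (no y≢b) (no x≢a) (no x≢b) k _ =
      trans (before-∷-ignore (b ∷ v) k y≢a x≢a) (trans (before-∷-ignore v k y≢b x≢b)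
        (sym (trans (before-∷-ignore (a ∷ v) k y≢b x≢b) (before-∷-ignore v k y≢a x≢a))))

  before-swap : ∀ (u v : Word n) l → ¬ (x ≡ a × y ≡ b × l ≡ occ b u) →
                before (u ++ a ∷ b ∷ v) x y l ≡ before (u ++ b ∷ a ∷ v) x y l
  before-swap u v l exception with l ℕ.<? occ y u
  ... | yes l<occ = trans (before-++-early x y u _ l l<occ) (sym (before-++-early x y u _ l l<occ))
  ... | no l≮occ = subst (λ l → before (u ++ a ∷ b ∷ v) x y l ≡ before (u ++ b ∷ a ∷ v) x y l) occ+k≡l
      (trans (before-++-late x y (FinP.<⇒≢ x<y) u _ k)
        (trans (cong (occ x u +_) (before-adjacent-swap v k local-exception))
          (sym (before-++-late x y (FinP.<⇒≢ x<y) u _ k))))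
    where
    k = l ∸ occ y u
    occ+k≡l : occ y u + k ≡ l
    occ+k≡l = ℕP.m+[n∸m]≡n (ℕP.≮⇒≥ l≮occ)
    local-exception : ¬ (x ≡ a × y ≡ b × k ≡ 0)
    local-exception (refl , refl , k≡0) =
      exception (refl , refl , trans (sym occ+k≡l) (trans (cong (occ y u +_) k≡0) (ℕP.+-identityʳ _)))

before-swap-critical : ∀ {a b : Fin n} → a Fin.< b → (u v : Word n) →
                       before (u ++ a ∷ b ∷ v) a b (occ b u) ≡ suc (before (u ++ b ∷ a ∷ v) a b (occ b u))
before-swap-critical {a = a} {b} a<b u v = begin
  before (u ++ a ∷ b ∷ v) a b (occ b u)      ≡⟨ at-occ (a ∷ b ∷ v) ⟩
  occ a u + before (a ∷ b ∷ v) a b 0         ≡⟨ cong (occ a u +_) (before-∷-count (b ∷ v) 0 (a≢b ∘ sym) refl) ⟩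
  occ a u + suc (before (b ∷ v) a b 0)       ≡⟨ cong (λ k → occ a u + suc k) (before-∷-stop {x = a} {y = b} v refl) ⟩
  occ a u + 1                                ≡⟨ ℕP.+-suc (occ a u) 0 ⟩
  suc (occ a u + 0)                          ≡⟨ cong (λ k → suc (occ a u + k)) (before-∷-stop {x = a} {y = b} (a ∷ v) refl) ⟨
  suc (occ a u + before (b ∷ a ∷ v) a b 0)   ≡⟨ cong suc (at-occ (b ∷ a ∷ v)) ⟨
  suc (before (u ++ b ∷ a ∷ v) a b (occ b u)) ∎
  where
  open ≡-Reasoning
  a≢b = FinP.<⇒≢ a<b
  at-occ : ∀ r → before (u ++ r) a b (occ b u) ≡ occ a u + before r a b 0
  at-occ r = subst (λ k → before (u ++ r) a b k ≡ occ a u + before r a b 0)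
               (ℕP.+-identityʳ (occ b u)) (before-++-late a b a≢b u r 0)

-- The order of BL(m) as a dominance order

_⊑_ : Word n → Word n → Set
_⊑_ {n} s t = ∀ (x y : Fin n) → x Fin.< y → ∀ l → before t x y l ℕ.≤ before s x y l

⊑-refl : ∀ {s : Word n} → s ⊑ s
⊑-refl x y x<y l = ℕP.≤-refl

⊑-trans : ∀ {s t r : Word n} → s ⊑ t → t ⊑ r → s ⊑ r
⊑-trans s⊑t t⊑r x y x<y l = ℕP.≤-trans (t⊑r x y x<y l) (s⊑t x y x<y l)

⋖⇒⊑ : ∀ {s t : Word n} → s ⋖ t → s ⊑ t
⋖⇒⊑ (u , v , a , b , a<b , refl , refl) x y x<y l with (x ≟ a) ×-dec (y ≟ b) ×-dec (l ℕ.≟ occ b u)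
... | yes (refl , refl , refl) = ℕP.≤-trans (ℕP.n≤1+n _) (ℕP.≤-reflexive (sym (before-swap-critical a<b u v)))
... | no exception = ℕP.≤-reflexive (sym (before-swap a<b x<y u v l exception))

⋖*⇒⊑ : ∀ {s t : Word n} → Star _⋖_ s t → s ⊑ t
⋖*⇒⊑ {s = s} ε = ⊑-refl {s = s}
⋖*⇒⊑ {s = s} {r} (_◅_ {j = t} s⋖t t⋖*r) = ⊑-trans {s = s} {t} {r} (⋖⇒⊑ s⋖t) (⋖*⇒⊑ t⋖*r)

⋖⇒⋣ : ∀ {s t : Word n} → s ⋖ t → ¬ t ⊑ s
⋖⇒⋣ (u , v , a , b , a<b , refl , refl) t⊑s = ℕP.<-irrefl refl
  (ℕP.≤-trans (ℕP.≤-reflexive (sym (before-swap-critical a<b u v))) (t⊑s _ _ a<b _))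

∷-⋖* : ∀ (z : Fin n) {s t : Word n} → Star _⋖_ s t → Star _⋖_ (z ∷ s) (z ∷ t)
∷-⋖* z = Star.gmap (z ∷_) λ where (u , v , a , b , a<b , refl , refl) → z ∷ u , v , a , b , a<b , refl , refl

split-at-first : ∀ (x : Fin n) (s : Word n) → 1 ℕ.≤ occ x s →
                 ∃[ s₁ ] ∃[ s₂ ] (s ≡ s₁ ++ x ∷ s₂ × occ x s₁ ≡ 0)
split-at-first x (z ∷ s) x∈s with x ≟ z
... | yes refl = [] , s , refl , refl
... | no x≢z with split-at-first x s x∈s
...   | s₁ , s₂ , refl , x∉s₁ = z ∷ s₁ , s₂ , refl , trans (occ-∷-≢ s₁ x≢z) x∉s₁

bubble-to-front : ∀ (x : Fin n) (s₁ s₂ : Word n) → (∀ p y q → s₁ ≡ p ++ y ∷ q → y Fin.< x) →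
                  Star _⋖_ (s₁ ++ x ∷ s₂) (x ∷ s₁ ++ s₂)
bubble-to-front x [] s₂ below = ε
bubble-to-front x (y ∷ s₁) s₂ below =
  ∷-⋖* y (bubble-to-front x s₁ s₂ λ p y′ q s₁≡ → below (y ∷ p) y′ q (cong (y ∷_) s₁≡))
  ◅◅ (([] , s₁ ++ s₂ , y , x , below [] y s₁ refl , refl , refl) ◅ ε)

first-occurrence-prefix-< : ∀ (x : Fin n) (s₁ s₂ t : Word n) → occ x s₁ ≡ 0 → (s₁ ++ x ∷ s₂) ⊑ (x ∷ t) →
                         ∀ p y q → s₁ ≡ p ++ y ∷ q → y Fin.< x
first-occurrence-prefix-< x s₁ s₂ t x∉s₁ s⊑xt p y q refl with FinP.<-cmp y x
... | tri< y<x _ _ = y<x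
... | tri≈ _ refl _ = ⊥-elim (ℕP.<-irrefl (sym x∉s₁) (occ-∈ x p q))
... | tri> _ y≢x x<y = ⊥-elim (ℕP.<-irrefl refl (begin-strict
    0                                          <⟨ s≤s z≤n ⟩
    suc (before t x y (occ y p))               ≡⟨ before-∷-count t (occ y p) y≢x refl ⟨
    before (x ∷ t) x y (occ y p)               ≤⟨ s⊑xt x y x<y (occ y p) ⟩
    before ((p ++ y ∷ q) ++ x ∷ s₂) x y (occ y p) ≡⟨ x-free-before-y ⟩
    0                                          ∎))
  where
  open ℕP.≤-Reasoning
  x∉p : occ x p ≡ 0
  x∉p = ℕP.m+n≡0⇒m≡0 (occ x p) (trans (sym (occ-++ x p (y ∷ q))) x∉s₁)
  x-free-before-y : before ((p ++ y ∷ q) ++ x ∷ s₂) x y (occ y p) ≡ 0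
  x-free-before-y = begin-equality
    before ((p ++ y ∷ q) ++ x ∷ s₂) x y (occ y p)     ≡⟨ cong (λ r → before r x y (occ y p)) (ListP.++-assoc p (y ∷ q) _) ⟩
    before (p ++ y ∷ q ++ x ∷ s₂) x y (occ y p)       ≡⟨ cong (λ k → before (p ++ y ∷ q ++ x ∷ s₂) x y k) (ℕP.+-identityʳ _) ⟨
    before (p ++ y ∷ q ++ x ∷ s₂) x y (occ y p + 0)   ≡⟨ before-++-late x y (y≢x ∘ sym) p _ 0 ⟩
    occ x p + before (y ∷ q ++ x ∷ s₂) x y 0          ≡⟨ cong₂ _+_ x∉p (before-∷-stop {x = x} {y = y} (q ++ x ∷ s₂) refl) ⟩
    0                                                 ∎

⊑-drop-first : ∀ (x : Fin n) (s₁ s₂ t : Word n) → occ x s₁ ≡ 0 → (s₁ ++ x ∷ s₂) ⊑ (x ∷ t) → (s₁ ++ s₂) ⊑ t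
⊑-drop-first x s₁ s₂ t x∉s₁ s⊑xt a b a<b l with b ≟ x
... | yes refl = begin
  before t a b l                        ≡⟨ before-∷-pass t l refl ⟨
  before (b ∷ t) a b (suc l)            ≤⟨ s⊑xt a b a<b (suc l) ⟩
  before (s₁ ++ b ∷ s₂) a b (suc l)     ≡⟨ before-++-absent a b a≢b s₁ (b ∷ s₂) (suc l) x∉s₁ ⟩
  occ a s₁ + before (b ∷ s₂) a b (suc l) ≡⟨ cong (occ a s₁ +_) (before-∷-pass s₂ l refl) ⟩
  occ a s₁ + before s₂ a b l            ≡⟨ before-++-absent a b a≢b s₁ s₂ l x∉s₁ ⟨
  before (s₁ ++ s₂) a b l               ∎
  where
  open ℕP.≤-Reasoning
  a≢b = FinP.<⇒≢ a<b
... | no b≢x with a ≟ x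
...   | yes refl = ℕP.≤-pred (begin
  suc (before t a b l)                  ≡⟨ before-∷-count t l b≢x refl ⟨
  before (a ∷ t) a b l                  ≤⟨ s⊑xt a b a<b l ⟩
  before (s₁ ++ a ∷ s₂) a b l           ≤⟨ before-insert-≤ a b a (b≢x ∘ sym) s₁ s₂ l ⟩
  suc (before (s₁ ++ s₂) a b l)         ∎)
  where open ℕP.≤-Reasoning
...   | no a≢x = begin
  before t a b l                        ≡⟨ before-∷-ignore t l b≢x a≢x ⟨
  before (x ∷ t) a b l                  ≤⟨ s⊑xt a b a<b l ⟩
  before (s₁ ++ x ∷ s₂) a b l           ≡⟨ before-insert a b x (a≢x ∘ sym) (b≢x ∘ sym) s₁ s₂ l ⟩
  before (s₁ ++ s₂) a b l               ∎
  where open ℕP.≤-Reasoning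

⊑⇒⋖* : ∀ (s t : Word n) → (∀ y → occ y s ≡ occ y t) → s ⊑ t → Star _⋖_ s t
⊑⇒⋖* [] [] _ _ = ε
⊑⇒⋖* (z ∷ s) [] same _ = ⊥-elim (ℕP.<-irrefl (sym (same z)) (occ-∈ z [] s))
⊑⇒⋖* s (x ∷ t) same s⊑xt with split-at-first x s (subst (1 ℕ.≤_) (sym (same x)) (occ-∈ x [] t))
... | s₁ , s₂ , refl , x∉s₁ =
  bubble-to-front x s₁ s₂ (first-occurrence-prefix-< x s₁ s₂ t x∉s₁ s⊑xt)
  ◅◅ ∷-⋖* x (⊑⇒⋖* (s₁ ++ s₂) t same′ (⊑-drop-first x s₁ s₂ t x∉s₁ s⊑xt))
  where
  same′ : ∀ y → occ y (s₁ ++ s₂) ≡ occ y t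
  same′ y = occ-∷-cancel y x (s₁ ++ s₂) t (trans (sym (occ-move-to-front y x s₁ s₂)) (same y))

prefix-determined-by-occ : ∀ (b : Fin n) (u u₂ r r₂ : Word n) →
                           u ++ b ∷ r ≡ u₂ ++ b ∷ r₂ → occ b u ≡ occ b u₂ → u ≡ u₂
prefix-determined-by-occ b [] [] r r₂ eq same = refl
prefix-determined-by-occ b [] (z ∷ u₂) r r₂ eq same =
  ⊥-elim (ℕP.0≢1+n (trans same (occ-∷-≡ u₂ (ListP.∷-injectiveˡ eq))))
prefix-determined-by-occ b (z ∷ u) [] r r₂ eq same =
  ⊥-elim (ℕP.0≢1+n (trans (sym same) (occ-∷-≡ u (sym (ListP.∷-injectiveˡ eq)))))
prefix-determined-by-occ b (z ∷ u) (z₂ ∷ u₂) r r₂ eq same with ListP.∷-injective eq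
... | refl , eq′ = cong (z ∷_) (prefix-determined-by-occ b u u₂ r r₂ eq′ (occ-∷-cancel b z u u₂ same))

-- Only one triple (x, y, l) distinguishes w from each of its two lower covers, and the
-- two triples differ; the other cover then controls that triple.
⊑-from-two-covers : ∀ {a b a₂ b₂ : Fin n} {t : Word n} → a Fin.< b → a₂ Fin.< b₂ → (u v u₂ v₂ : Word n) →
                    u ++ b ∷ a ∷ v ≡ u₂ ++ b₂ ∷ a₂ ∷ v₂ → u ≢ u₂ →
                    (u ++ a ∷ b ∷ v) ⊑ t → (u₂ ++ a₂ ∷ b₂ ∷ v₂) ⊑ t → (u ++ b ∷ a ∷ v) ⊑ t
⊑-from-two-covers {a = a} {b} {a₂} {b₂} a<b a₂<b₂ u v u₂ v₂ w≡ u≢u₂ cover⊑t cover₂⊑t x y x<y l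
  with (x ≟ a) ×-dec (y ≟ b) ×-dec (l ℕ.≟ occ b u)
... | no exception = ℕP.≤-trans (cover⊑t x y x<y l) (ℕP.≤-reflexive (before-swap a<b x<y u v l exception))
... | yes (refl , refl , refl) with (x ≟ a₂) ×-dec (y ≟ b₂) ×-dec (l ℕ.≟ occ b₂ u₂)
...   | yes (refl , refl , same) = ⊥-elim (u≢u₂ (prefix-determined-by-occ y u u₂ (x ∷ v) (x ∷ v₂) w≡ same))
...   | no exception₂ = ℕP.≤-trans (cover₂⊑t x y x<y l)
        (ℕP.≤-reflexive (trans (before-swap a₂<b₂ x<y u₂ v₂ l exception₂) (cong (λ r → before r x y l) (sym w≡))))

FirstBefore-[] : ∀ {a b : Fin n} → FirstBefore a b []
FirstBefore-[] [] v ()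
FirstBefore-[] (_ ∷ _) v ()

FirstBefore-∷-first : ∀ {a b z : Fin n} {w : Word n} → a ≢ b → z ≡ a → FirstBefore a b (z ∷ w)
FirstBefore-∷-first a≢b z≡a [] v eq = ⊥-elim (a≢b (trans (sym z≡a) (ListP.∷-injectiveˡ eq)))
FirstBefore-∷-first a≢b z≡a (_ ∷ u) v eq = here (trans (sym z≡a) (ListP.∷-injectiveˡ eq))

FirstBefore-∷ : ∀ {a b z : Fin n} {w : Word n} → z ≢ b → FirstBefore a b w → FirstBefore a b (z ∷ w)
FirstBefore-∷ z≢b a-first [] v eq = ⊥-elim (z≢b (ListP.∷-injectiveˡ eq))
FirstBefore-∷ z≢b a-first (_ ∷ u) v eq = there (a-first u v (ListP.∷-injectiveʳ eq))

FirstBefore-∷⁻ : ∀ {a b z : Fin n} {w : Word n} → FirstBefore a b (z ∷ w) →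
                 z ≡ a ⊎ (z ≢ b × FirstBefore a b w)
FirstBefore-∷⁻ {a = a} {b} {z} {w} a-first with z ≟ a
... | yes z≡a = inj₁ z≡a
... | no z≢a = inj₂ ((λ z≡b → a∉[] (a-first [] w (cong (_∷ w) z≡b))) , λ u v eq → a∈tail (a-first (z ∷ u) v (cong (z ∷_) eq)))
  where
  a∉[] : a ∈ [] → ⊥
  a∉[] ()
  a∈tail : ∀ {u} → a ∈ (z ∷ u) → a ∈ u
  a∈tail (here a≡z) = ⊥-elim (z≢a (sym a≡z))
  a∈tail (there a∈u) = a∈u

FirstBefore-unswap : ∀ {i j a b : Fin n} → i Fin.< j → a Fin.< b → (u v : Word n) →
                     FirstBefore i j (u ++ b ∷ a ∷ v) → FirstBefore i j (u ++ a ∷ b ∷ v)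
FirstBefore-unswap {i = i} {j} {a} {b} i<j a<b [] v i-first with FirstBefore-∷⁻ i-first
... | inj₁ b≡i = FirstBefore-∷ a≢j (FirstBefore-∷-first (FinP.<⇒≢ i<j) b≡i)
  where
  a≢j : a ≢ j
  a≢j = FinP.<⇒≢ (FinP.<-trans a<b (subst (Fin._< j) (sym b≡i) i<j))
... | inj₂ (b≢j , i-first′) with FirstBefore-∷⁻ i-first′
...   | inj₁ a≡i = FirstBefore-∷-first (FinP.<⇒≢ i<j) a≡i
...   | inj₂ (a≢j , i-first″) = FirstBefore-∷ a≢j (FirstBefore-∷ b≢j i-first″)
FirstBefore-unswap i<j a<b (z ∷ u) v i-first with FirstBefore-∷⁻ i-first
... | inj₁ z≡i = FirstBefore-∷-first (FinP.<⇒≢ i<j) z≡i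
... | inj₂ (z≢j , i-first′) = FirstBefore-∷ z≢j (FirstBefore-unswap i<j a<b u v i-first′)

-- Descents and join-irreducibility

descents-from : Fin n → Word n → ℕ
descents-from x [] = 0
descents-from x (y ∷ w) with y FinP.<? x
... | yes _ = suc (descents-from y w)
... | no _ = descents-from y w

descents : Word n → ℕ
descents [] = 0
descents (x ∷ w) = descents-from x w

DescentAfter : Word n → Word n → Set
DescentAfter {n} w u = ∃[ v ] ∃[ a ] ∃[ b ] (a Fin.< b × w ≡ u ++ b ∷ a ∷ v)

module _ {a b : Fin n} (v : Word n) where

  descents-descent : a Fin.< b → descents (b ∷ a ∷ v) ≡ suc (descents (a ∷ v))
  descents-descent a<b with a FinP.<? b
  ... | yes _ = refl
  ... | no a≮b = ⊥-elim (a≮b a<b)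

descents-∷ : ∀ (z : Fin n) (w : Word n) → descents w ℕ.≤ descents (z ∷ w)
descents-∷ z [] = z≤n
descents-∷ z (y ∷ w) with y FinP.<? z
... | yes _ = ℕP.n≤1+n _
... | no _ = ℕP.≤-refl

descents-++ : ∀ (u w : Word n) → descents w ℕ.≤ descents (u ++ w)
descents-++ [] w = ℕP.≤-refl
descents-++ (z ∷ u) w = ℕP.≤-trans (descents-++ u w) (descents-∷ z (u ++ w))

DescentAfter-∷ : ∀ (z : Fin n) {w u : Word n} → DescentAfter w u → DescentAfter (z ∷ w) (z ∷ u)
DescentAfter-∷ z (v , a , b , a<b , refl) = v , a , b , a<b , refl

DescentAfter⇒descents≥1 : ∀ (w u : Word n) → DescentAfter w u → 1 ℕ.≤ descents w
DescentAfter⇒descents≥1 w u (v , a , b , a<b , refl) = begin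
  1                          ≤⟨ s≤s z≤n ⟩
  suc (descents (a ∷ v))     ≡⟨ descents-descent v a<b ⟨
  descents (b ∷ a ∷ v)       ≤⟨ descents-++ u (b ∷ a ∷ v) ⟩
  descents (u ++ b ∷ a ∷ v)  ∎
  where open ℕP.≤-Reasoning

descents≥1⇒DescentAfter : ∀ (x : Fin n) (w : Word n) → 1 ℕ.≤ descents (x ∷ w) → ∃[ u ] DescentAfter (x ∷ w) u
descents≥1⇒DescentAfter x (y ∷ w) has-descent with y FinP.<? x
... | yes y<x = [] , w , y , x , y<x , refl
... | no _ with descents≥1⇒DescentAfter y w has-descent
...   | u , descent = x ∷ u , DescentAfter-∷ x descent

descents≥2⇒DescentAfter² : ∀ (x : Fin n) (w : Word n) → 2 ℕ.≤ descents (x ∷ w) →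
                           ∃[ u ] ∃[ u₂ ] (u ≢ u₂ × DescentAfter (x ∷ w) u × DescentAfter (x ∷ w) u₂)
descents≥2⇒DescentAfter² x (y ∷ w) has-descents with y FinP.<? x
... | yes y<x with descents≥1⇒DescentAfter y w (ℕP.≤-pred has-descents)
...   | u , descent = [] , x ∷ u , (λ ()) , (w , y , x , y<x , refl) , DescentAfter-∷ x descent
descents≥2⇒DescentAfter² x (y ∷ w) has-descents | no _ with descents≥2⇒DescentAfter² y w has-descents
...   | u , u₂ , u≢u₂ , descent , descent₂ =
  x ∷ u , x ∷ u₂ , u≢u₂ ∘ ListP.∷-injectiveʳ , DescentAfter-∷ x descent , DescentAfter-∷ x descent₂

DescentAfter²⇒descents≥2 : ∀ (w u u₂ : Word n) → u ≢ u₂ → DescentAfter w u → DescentAfter w u₂ → 2 ℕ.≤ descents w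
DescentAfter²⇒descents≥2 w [] [] u≢u₂ _ _ = ⊥-elim (u≢u₂ refl)
DescentAfter²⇒descents≥2 w [] (z ∷ u₂) _ first later = first-and-later w u₂ first later
  where
  first-and-later : ∀ w u₂ → DescentAfter w [] → DescentAfter w (z ∷ u₂) → 2 ℕ.≤ descents w
  first-and-later _ u₂ (v , a , b , a<b , refl) (v₂ , a₂ , b₂ , a₂<b₂ , eq) =
    subst (2 ℕ.≤_) (sym (descents-descent v a<b))
      (s≤s (DescentAfter⇒descents≥1 (a ∷ v) u₂ (v₂ , a₂ , b₂ , a₂<b₂ , ListP.∷-injectiveʳ eq)))
DescentAfter²⇒descents≥2 w (z ∷ u) [] u≢u₂ later first =
  DescentAfter²⇒descents≥2 w [] (z ∷ u) (u≢u₂ ∘ sym) first later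
DescentAfter²⇒descents≥2 (z ∷ w) (z′ ∷ u) (z″ ∷ u₂) u≢u₂ (v , a , b , a<b , eq) (v₂ , a₂ , b₂ , a₂<b₂ , eq₂)
  with ListP.∷-injective eq | ListP.∷-injective eq₂
... | refl , eq′ | refl , eq₂′ = ℕP.≤-trans
  (DescentAfter²⇒descents≥2 w u u₂ (u≢u₂ ∘ cong (z ∷_)) (v , a , b , a<b , eq′) (v₂ , a₂ , b₂ , a₂<b₂ , eq₂′))
  (descents-∷ z w)

sorted-tail : ∀ (z : Fin n) (w : Word n) → descents (z ∷ w) ≡ 0 → descents w ≡ 0
sorted-tail z w sorted = ℕP.n≤0⇒n≡0 (subst (descents w ℕ.≤_) sorted (descents-∷ z w))

sorted-head-least : ∀ (z : Fin n) (w : Word n) → descents (z ∷ w) ≡ 0 → ∀ x → x Fin.< z → occ x w ≡ 0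
sorted-head-least z [] sorted x x<z = refl
sorted-head-least z (y ∷ w) sorted x x<z with y FinP.<? z
... | yes _ = ⊥-elim (ℕP.1+n≢0 sorted)
... | no y≮z = trans (occ-∷-≢ w (FinP.<⇒≢ x<y)) (sorted-head-least y w sorted x x<y)
  where
  x<y : x Fin.< y
  x<y = ℕP.<-≤-trans x<z (ℕP.≮⇒≥ y≮z)

sorted-before : ∀ (w : Word n) → descents w ≡ 0 → ∀ (x y : Fin n) → x Fin.< y → ∀ l → before w x y l ≡ occ x w
sorted-before [] sorted x y x<y l = refl
sorted-before (z ∷ w) sorted x y x<y l with y ≟ z | x ≟ z
... | yes refl | yes refl = ⊥-elim (FinP.<-irrefl refl x<y)
sorted-before (z ∷ w) sorted x y x<y zero    | yes refl | no _ = sym (sorted-head-least z w sorted x x<y)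
sorted-before (z ∷ w) sorted x y x<y (suc l) | yes refl | no _ = sorted-before w (sorted-tail z w sorted) x y x<y l
... | no _ | yes _ = cong suc (sorted-before w (sorted-tail z w sorted) x y x<y l)
... | no _ | no _ = sorted-before w (sorted-tail z w sorted) x y x<y l

Star-last : ∀ {A : Set} {R : A → A → Set} {x w : A} → Star R x w → x ≡ w ⊎ ∃[ p ] (Star R x p × R p w)
Star-last ε = inj₁ refl
Star-last (r ◅ rs) with Star-last rs
... | inj₁ refl = inj₂ (_ , ε , r)
... | inj₂ (p , rs′ , r′) = inj₂ (p , r ◅ rs′ , r′)

⋖⇒DescentAfter : ∀ {s w : Word n} → ((u , _) : s ⋖ w) → DescentAfter w u
⋖⇒DescentAfter (u , v , a , b , a<b , _ , w≡) = v , a , b , a<b , w≡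

lower-cover : ∀ {w u : Word n} → DescentAfter w u → Word n
lower-cover {u = u} (v , a , b , _) = u ++ a ∷ b ∷ v

lower-cover-⋖ : ∀ {w u : Word n} (descent : DescentAfter w u) → lower-cover descent ⋖ w
lower-cover-⋖ {u = u} (v , a , b , a<b , w≡) = u , v , a , b , a<b , refl , w≡

⋖⇒≢ : ∀ {s w : Word n} → s ⋖ w → s ≢ w
⋖⇒≢ (u , v , a , b , a<b , refl , refl) eq = FinP.<⇒≢ a<b (ListP.∷-injectiveˡ (ListP.++-cancelˡ u _ _ eq))

module _ {m : Vec ℕ n} where

  InBL-⋖ : ∀ {s t : Word n} → s ⋖ t → InBL m t → InBL m s
  InBL-⋖ (u , v , a , b , a<b , refl , refl) (counts , firsts) =
    (λ i → trans (occ-swap i a b u v) (counts i)) ,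
    λ i j j≡1+i → FirstBefore-unswap (ℕP.≤-reflexive (sym j≡1+i)) a<b u v (firsts i j j≡1+i)

  InBL-⋖* : ∀ {s t : Word n} → Star _⋖_ s t → InBL m t → InBL m s
  InBL-⋖* ε t∈BL = t∈BL
  InBL-⋖* (s⋖r ◅ r⋖*t) t∈BL = InBL-⋖ s⋖r (InBL-⋖* r⋖*t t∈BL)

  ⋖*⇒≤ : ∀ {s t : Word n} → Star _⋖_ s t → InBL m t → s ≤[ m ] t
  ⋖*⇒≤ ε t∈BL = ε
  ⋖*⇒≤ (s⋖r ◅ r⋖*t) t∈BL =
    (InBL-⋖ s⋖r r∈BL , r∈BL , s⋖r) ◅ ⋖*⇒≤ r⋖*t t∈BL
    where r∈BL = InBL-⋖* r⋖*t t∈BL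

  ≤⇒⋖* : ∀ {s t : Word n} → s ≤[ m ] t → Star _⋖_ s t
  ≤⇒⋖* = Star.map (proj₂ ∘ proj₂)

  ⊑⇒≤ : ∀ {s t : Word n} → InBL m s → InBL m t → s ⊑ t → s ≤[ m ] t
  ⊑⇒≤ {s} {t} (s-counts , _) t∈BL@(t-counts , _) s⊑t =
    ⋖*⇒≤ (⊑⇒⋖* s t (λ y → trans (s-counts y) (sym (t-counts y))) s⊑t) t∈BL

  ≤⇒⊑ : ∀ {s t : Word n} → s ≤[ m ] t → s ⊑ t
  ≤⇒⊑ s≤t = ⋖*⇒⊑ (≤⇒⋖* s≤t)

  sorted⇒IsMin : ∀ (w : Word n) → descents w ≡ 0 → InBL m w → IsMin m w
  sorted⇒IsMin w sorted w∈BL@(w-counts , _) = w∈BL , λ u u∈BL@(u-counts , _) → ⊑⇒≤ w∈BL u∈BL λ x y x<y l → begin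
    before u x y l  ≤⟨ before≤occ x y u l ⟩
    occ x u         ≡⟨ trans (u-counts x) (sym (w-counts x)) ⟩
    occ x w         ≡⟨ sorted-before w sorted x y x<y l ⟨
    before w x y l  ∎
    where open ℕP.≤-Reasoning

  ⋖⇒< : ∀ {s w : Word n} → s ⋖ w → InBL m w → s <[ m ] w
  ⋖⇒< s⋖w w∈BL = (InBL-⋖ s⋖w w∈BL , w∈BL , s⋖w) ◅ ε , ⋖⇒≢ s⋖w

  two-lower-covers-join : ∀ {c c₂ w : Word n} → ((u , _) : c ⋖ w) → ((u₂ , _) : c₂ ⋖ w) → u ≢ u₂ →
                          InBL m w → IsJoin m c c₂ w
  two-lower-covers-join c⋖w@(u , v , a , b , a<b , refl , refl) c₂⋖w@(u₂ , v₂ , a₂ , b₂ , a₂<b₂ , refl , w≡) u≢u₂ w∈BL =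
    w∈BL , proj₁ (⋖⇒< c⋖w w∈BL) , proj₁ (⋖⇒< c₂⋖w w∈BL) , λ t t∈BL c≤t c₂≤t →
      ⊑⇒≤ w∈BL t∈BL (⊑-from-two-covers {t = t} a<b a₂<b₂ u v u₂ v₂ w≡ u≢u₂ (≤⇒⊑ c≤t) (≤⇒⊑ c₂≤t))

  JoinIrreducible⇒descents≡1 : ∀ (w : Word n) → JoinIrreducible m w → descents w ≡ 1
  JoinIrreducible⇒descents≡1 [] ([]∈BL , not-min , _) = ⊥-elim (not-min (sorted⇒IsMin [] refl []∈BL))
  JoinIrreducible⇒descents≡1 (x ∷ w) (w∈BL , not-min , not-join) with descents (x ∷ w) in count
  ... | zero = ⊥-elim (not-min (sorted⇒IsMin (x ∷ w) count w∈BL))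
  ... | suc zero = refl
  ... | suc (suc _) with descents≥2⇒DescentAfter² x w (subst (2 ℕ.≤_) (sym count) (s≤s (s≤s z≤n)))
  ...   | u , u₂ , u≢u₂ , descent , descent₂ = ⊥-elim (not-join (c , c₂ ,
            InBL-⋖ c⋖w w∈BL , InBL-⋖ c₂⋖w w∈BL , ⋖⇒< c⋖w w∈BL , ⋖⇒< c₂⋖w w∈BL ,
            two-lower-covers-join c⋖w c₂⋖w u≢u₂ w∈BL))
    where
    c = lower-cover descent
    c₂ = lower-cover descent₂
    c⋖w = lower-cover-⋖ descent
    c₂⋖w = lower-cover-⋖ descent₂

  descents≡1⇒JoinIrreducible : ∀ (w : Word n) → InBL m w → descents w ≡ 1 → JoinIrreducible m w
  descents≡1⇒JoinIrreducible w@(x ∷ t) w∈BL one with descents≥1⇒DescentAfter x t (ℕP.≤-reflexive (sym one))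
  ... | u , descent@(_ , _ , _ , _ , w≡) = w∈BL , not-min , not-join
    where
    c = lower-cover descent
    c⋖w = lower-cover-⋖ descent
    c∈BL = InBL-⋖ c⋖w w∈BL
    w≰c : ¬ w ≤[ m ] c
    w≰c w≤c = ⋖⇒⋣ c⋖w (≤⇒⊑ w≤c)
    not-min : ¬ IsMin m w
    not-min (_ , w≤all) = w≰c (w≤all c c∈BL)
    unique-cover : ∀ {c′} → c′ ⋖ w → c′ ≡ c
    unique-cover c′⋖w@(u₂ , v₂ , a₂ , b₂ , a₂<b₂ , refl , w≡₂) with ListP.≡-dec _≟_ u u₂
    ... | no u≢u₂ = ⊥-elim (ℕP.<-irrefl (sym one)
          (DescentAfter²⇒descents≥2 w u u₂ u≢u₂ descent (⋖⇒DescentAfter c′⋖w)))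
    ... | yes refl with ListP.++-cancelˡ u _ _ (trans (sym w≡) w≡₂)
    ...   | refl = refl
    below-c : ∀ {y} → y <[ m ] w → y ≤[ m ] c
    below-c (y≤w , y≢w) with Star-last y≤w
    ... | inj₁ y≡w = ⊥-elim (y≢w y≡w)
    ... | inj₂ (_ , y≤p , (_ , _ , p⋖w)) = subst (_ ≤[ m ]_) (unique-cover p⋖w) y≤p
    not-join : ¬ (∃[ y ] ∃[ z ] (InBL m y × InBL m z × y <[ m ] w × z <[ m ] w × IsJoin m y z w))
    not-join (_ , _ , _ , _ , y<w , z<w , (_ , _ , _ , least)) = w≰c (least c c∈BL (below-c y<w) (below-c z<w))

-- Splitting off the letter 0

lower : Word (suc n) → Word n
lower [] = []
lower (zero ∷ w) = lower w
lower (suc x ∷ w) = x ∷ lower w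

zeros : ℕ → Word (suc n)
zeros k = replicate k zero

StartsWithZero : Word (suc n) → Set
StartsWithZero [] = ⊤
StartsWithZero (x ∷ _) = x ≡ zero

module _ {n : ℕ} where
  private
    V = Word n
    W = Word (suc n)

  occ-lower : ∀ (x : Fin n) (w : W) → occ x (lower w) ≡ occ (suc x) w
  occ-lower x [] = refl
  occ-lower x (zero ∷ w) = occ-lower x w
  occ-lower x (suc z ∷ w) with x ≟ z
  ... | yes refl = cong suc (occ-lower x w)
  ... | no _ = occ-lower x w

  FirstBefore-lower⁺ : ∀ {i j : Fin n} → i ≢ j → (w : W) → FirstBefore (suc i) (suc j) w → FirstBefore i j (lower w)
  FirstBefore-lower⁺ i≢j [] _ = FirstBefore-[]
  FirstBefore-lower⁺ i≢j (zero ∷ w) i-first with FirstBefore-∷⁻ i-first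
  ... | inj₂ (_ , i-first′) = FirstBefore-lower⁺ i≢j w i-first′
  FirstBefore-lower⁺ i≢j (suc z ∷ w) i-first with FirstBefore-∷⁻ i-first
  ... | inj₁ z≡i = FirstBefore-∷-first i≢j (FinP.suc-injective z≡i)
  ... | inj₂ (z≢j , i-first′) = FirstBefore-∷ (z≢j ∘ cong suc) (FirstBefore-lower⁺ i≢j w i-first′)

  FirstBefore-lower⁻ : ∀ {i j : Fin n} → i ≢ j → (w : W) → FirstBefore i j (lower w) → FirstBefore (suc i) (suc j) w
  FirstBefore-lower⁻ i≢j [] _ = FirstBefore-[]
  FirstBefore-lower⁻ i≢j (zero ∷ w) i-first = FirstBefore-∷ (λ ()) (FirstBefore-lower⁻ i≢j w i-first)
  FirstBefore-lower⁻ i≢j (suc z ∷ w) i-first with FirstBefore-∷⁻ i-first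
  ... | inj₁ z≡i = FirstBefore-∷-first (i≢j ∘ FinP.suc-injective) (cong suc z≡i)
  ... | inj₂ (z≢j , i-first′) = FirstBefore-∷ (z≢j ∘ FinP.suc-injective) (FirstBefore-lower⁻ i≢j w i-first′)

  InBL⇒StartsWithZero : ∀ {m : Vec ℕ (suc n)} (w : W) → InBL m w → StartsWithZero w
  InBL⇒StartsWithZero [] _ = tt
  InBL⇒StartsWithZero (zero ∷ w) _ = refl
  InBL⇒StartsWithZero (suc y ∷ w) (_ , firsts)
    with () ← firsts (Fin.inject₁ y) (suc y) (cong suc (sym (FinP.toℕ-inject₁ y))) [] w refl

  InBL-∷⁻ : ∀ {m₀ : ℕ} {ms : Vec ℕ n} (w : W) → InBL (m₀ ∷ ms) w →
            occ zero w ≡ m₀ × InBL ms (lower w) × StartsWithZero w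
  InBL-∷⁻ {m₀} {ms} w w∈BL@(counts , firsts) =
    counts zero ,
    ((λ i → trans (occ-lower i w) (counts (suc i))) ,
     λ i j j≡1+i → FirstBefore-lower⁺ (FinP.<⇒≢ (ℕP.≤-reflexive (sym j≡1+i))) w (firsts (suc i) (suc j) (cong suc j≡1+i))) ,
    InBL⇒StartsWithZero {m = m₀ ∷ ms} w w∈BL

  InBL-∷⁺ : ∀ {m₀ : ℕ} {ms : Vec ℕ n} (w : W) → occ zero w ≡ m₀ → InBL ms (lower w) → StartsWithZero w → InBL (m₀ ∷ ms) w
  InBL-∷⁺ {m₀} {ms} w zeros-ok (counts , firsts) starts = counts′ , firsts′
    where
    counts′ : ∀ i → occ i w ≡ lookup (m₀ ∷ ms) i
    counts′ zero = zeros-ok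
    counts′ (suc i) = trans (sym (occ-lower i w)) (counts i)
    zero-first : ∀ {j} (w : W) → j ≢ zero → StartsWithZero w → FirstBefore zero j w
    zero-first [] _ _ = FirstBefore-[]
    zero-first (x ∷ w) j≢0 x≡0 = FirstBefore-∷-first (j≢0 ∘ sym) x≡0
    firsts′ : ∀ i j → toℕ j ≡ suc (toℕ i) → FirstBefore i j w
    firsts′ zero (suc j) _ = zero-first w (λ ()) starts
    firsts′ (suc i) (suc j) j≡1+i = FirstBefore-lower⁻ (FinP.<⇒≢ (ℕP.≤-reflexive (sym j≡1+i′))) w (firsts i j j≡1+i′)
      where j≡1+i′ = ℕP.suc-injective j≡1+i

  lower-++ : ∀ (u v : W) → lower (u ++ v) ≡ lower u ++ lower v
  lower-++ [] v = refl
  lower-++ (zero ∷ u) v = lower-++ u v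
  lower-++ (suc x ∷ u) v = cong (x ∷_) (lower-++ u v)

  lower-block : ∀ k (A : V) → lower (zeros k ++ map suc A) ≡ A
  lower-block zero [] = refl
  lower-block zero (x ∷ A) = cong (x ∷_) (lower-block zero A)
  lower-block (suc k) A = lower-block k A

  occ-zero-block : ∀ k (A : V) → occ zero (zeros k ++ map suc A) ≡ k
  occ-zero-block zero [] = refl
  occ-zero-block zero (x ∷ A) = occ-zero-block zero A
  occ-zero-block (suc k) A = cong suc (occ-zero-block k A)

  descents-zero-∷ : ∀ (w : W) → descents (zero ∷ w) ≡ descents w
  descents-zero-∷ [] = refl
  descents-zero-∷ (y ∷ w) with y FinP.<? zero {n}
  ... | no _ = refl

  descents-from-suc : ∀ (x : Fin n) (A : V) → descents-from (suc x) (map suc A) ≡ descents-from x A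
  descents-from-suc x [] = refl
  descents-from-suc x (y ∷ A) with suc y FinP.<? suc x | y FinP.<? x
  ... | yes _ | yes _ = cong suc (descents-from-suc y A)
  ... | no _ | no _ = descents-from-suc y A
  ... | yes 1+y<1+x | no y≮x = ⊥-elim (y≮x (ℕP.≤-pred 1+y<1+x))
  ... | no 1+y≮1+x | yes y<x = ⊥-elim (1+y≮1+x (s≤s y<x))

  descents-map-suc : ∀ (A : V) → descents (map suc A) ≡ descents A
  descents-map-suc [] = refl
  descents-map-suc (x ∷ A) = descents-from-suc x A

  descents-zeros-++ : ∀ k (w : W) → descents (zeros k ++ w) ≡ descents w
  descents-zeros-++ zero w = refl
  descents-zeros-++ (suc k) w = trans (descents-zero-∷ (zeros k ++ w)) (descents-zeros-++ k w)

  descents-block : ∀ k (A : V) → descents (zeros k ++ map suc A) ≡ descents A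
  descents-block k A = trans (descents-zeros-++ k (map suc A)) (descents-map-suc A)

  descents-junction : ∀ (x : Fin n) (A : V) (X : W) →
                      descents (suc x ∷ map suc A ++ zero ∷ X) ≡ descents (x ∷ A) + suc (descents (zero ∷ X))
  descents-junction x [] X with zero {n} FinP.<? suc x
  ... | yes _ = refl
  ... | no 0≮1+x = ⊥-elim (0≮1+x (s≤s z≤n))
  descents-junction x (y ∷ A) X with suc y FinP.<? suc x | y FinP.<? x
  ... | yes _ | yes _ = cong suc (descents-junction y A X)
  ... | no _ | no _ = descents-junction y A X
  ... | yes 1+y<1+x | no y≮x = ⊥-elim (y≮x (ℕP.≤-pred 1+y<1+x))
  ... | no 1+y≮1+x | yes y<x = ⊥-elim (1+y≮1+x (s≤s y<x))

  sorted-after-nonzero : ∀ (x : Fin n) (w : W) → descents (suc x ∷ w) ≡ 0 → w ≡ map suc (lower w)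
  sorted-after-nonzero x [] _ = refl
  sorted-after-nonzero x (y ∷ w) sorted with y FinP.<? suc x
  sorted-after-nonzero x (zero ∷ w) sorted | no 0≮1+x = ⊥-elim (0≮1+x (s≤s z≤n))
  sorted-after-nonzero x (suc y ∷ w) sorted | no _ = cong (suc y ∷_) (sorted-after-nonzero y w sorted)
  ... | yes _ = ⊥-elim (ℕP.1+n≢0 sorted)

  sorted-decomposition : ∀ (w : W) → descents w ≡ 0 → w ≡ zeros (occ zero w) ++ map suc (lower w)
  sorted-decomposition [] _ = refl
  sorted-decomposition (zero ∷ w) sorted =
    cong (zero ∷_) (sorted-decomposition w (trans (sym (descents-zero-∷ w)) sorted))
  sorted-decomposition (suc x ∷ w) sorted = begin
    suc x ∷ w                                      ≡⟨ cong (suc x ∷_) (sorted-after-nonzero x w sorted) ⟩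
    suc x ∷ map suc (lower w)                      ≡⟨ cong (λ k → zeros k ++ suc x ∷ map suc (lower w)) no-zeros ⟨
    zeros (occ zero w) ++ suc x ∷ map suc (lower w) ∎
    where
    open ≡-Reasoning
    no-zeros : occ zero w ≡ 0
    no-zeros = trans (cong (occ zero) (sorted-after-nonzero x w sorted)) (occ-zero-block 0 (lower w))

  sorted-lower : ∀ (w : W) → descents w ≡ 0 → descents (lower w) ≡ 0
  sorted-lower w sorted = begin
    descents (lower w)                                      ≡⟨ descents-block (occ zero w) (lower w) ⟨
    descents (zeros (occ zero w) ++ map suc (lower w))      ≡⟨ cong descents (sorted-decomposition w sorted) ⟨
    descents w                                              ≡⟨ sorted ⟩
    0                                                       ∎
    where open ≡-Reasoning

  InBL-zeros-++ : ∀ {k : ℕ} {ms : Vec ℕ n} (A : V) → 1 ℕ.≤ k → InBL ms A → InBL (k ∷ ms) (zeros k ++ map suc A)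
  InBL-zeros-++ {suc k} {ms} A _ A∈BL =
    InBL-∷⁺ (zeros (suc k) ++ map suc A) (occ-zero-block (suc k) A)
      (subst (InBL ms) (sym (lower-block (suc k) A)) A∈BL) refl

Positive : Vec ℕ n → Set
Positive m = ∀ i → 1 ℕ.≤ lookup m i

sortedWord : Vec ℕ n → Word n
sortedWord [] = []
sortedWord (k ∷ ms) = zeros k ++ map suc (sortedWord ms)

descents-sortedWord : ∀ (m : Vec ℕ n) → descents (sortedWord m) ≡ 0
descents-sortedWord [] = refl
descents-sortedWord (k ∷ ms) = trans (descents-block k (sortedWord ms)) (descents-sortedWord ms)

sortedWord∈BL : ∀ (m : Vec ℕ n) → Positive m → InBL m (sortedWord m)
sortedWord∈BL [] _ = (λ ()) , λ ()
sortedWord∈BL (k ∷ ms) positive =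
  InBL-zeros-++ (sortedWord ms) (positive zero) (sortedWord∈BL ms (positive ∘ suc))

sorted-unique : ∀ (m : Vec ℕ n) (w : Word n) → descents w ≡ 0 → (∀ i → occ i w ≡ lookup m i) → w ≡ sortedWord m
sorted-unique [] [] _ _ = refl
sorted-unique (k ∷ ms) w sorted counts = begin
  w                                           ≡⟨ sorted-decomposition w sorted ⟩
  zeros (occ zero w) ++ map suc (lower w)     ≡⟨ cong₂ (λ k A → zeros k ++ map suc A) (counts zero)
                                                   (sorted-unique ms (lower w) (sorted-lower w sorted) lower-counts) ⟩
  zeros k ++ map suc (sortedWord ms)          ∎
  where
  open ≡-Reasoning
  lower-counts : ∀ i → occ i (lower w) ≡ lookup ms i
  lower-counts i = trans (occ-lower i w) (counts (suc i))

module _ {A B : Set} (f : ℕ → A → B) (xs : List A) where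

  tagged : ℕ → List B
  tagged zero = []
  tagged (suc k) = map (f (suc k)) xs ++ tagged k

  ∈-tagged⁺ : ∀ {a x} k → 1 ℕ.≤ a → a ℕ.≤ k → x ∈ xs → f a x ∈ tagged k
  ∈-tagged⁺ zero 1≤a a≤0 = ⊥-elim (ℕP.<-irrefl refl (ℕP.≤-trans 1≤a a≤0))
  ∈-tagged⁺ {a} (suc k) 1≤a a≤1+k x∈xs with a ℕ.≟ suc k
  ... | yes refl = ∈-++⁺ˡ (∈-map⁺ (f (suc k)) x∈xs)
  ... | no a≢1+k = ∈-++⁺ʳ (map (f (suc k)) xs) (∈-tagged⁺ k 1≤a (ℕP.≤-pred (ℕP.≤∧≢⇒< a≤1+k a≢1+k)) x∈xs)

  ∈-tagged⁻ : ∀ {y} k → y ∈ tagged k → ∃[ a ] ∃[ x ] (1 ℕ.≤ a × a ℕ.≤ k × x ∈ xs × y ≡ f a x)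
  ∈-tagged⁻ (suc k) y∈ with ∈-++⁻ (map (f (suc k)) xs) y∈
  ... | inj₁ y∈map with ∈-map⁻ (f (suc k)) y∈map
  ...   | x , x∈xs , y≡ = suc k , x , s≤s z≤n , ℕP.≤-refl , x∈xs , y≡
  ∈-tagged⁻ (suc k) y∈ | inj₂ y∈rest with ∈-tagged⁻ k y∈rest
  ...   | a , x , 1≤a , a≤k , x∈xs , y≡ = a , x , 1≤a , ℕP.m≤n⇒m≤1+n a≤k , x∈xs , y≡

  length-tagged : ∀ k → length (tagged k) ≡ k ℕ.* length xs
  length-tagged zero = refl
  length-tagged (suc k) = trans (ListP.length-++ (map (f (suc k)) xs))
    (cong₂ _+_ (ListP.length-map (f (suc k)) xs) (length-tagged k))

  tagged-unique : (tag : B → ℕ) → (∀ a {x} → x ∈ xs → tag (f a x) ≡ a) → ∀ k →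
                  (∀ {a} → a ℕ.≤ k → ∀ {x y} → f a x ≡ f a y → x ≡ y) → Unique xs → Unique (tagged k)
  tagged-unique tag tag-f zero _ _ = []
  tagged-unique tag tag-f (suc k) injective xs! = Unique.++⁺
    (Unique.map⁺ (injective ℕP.≤-refl) xs!)
    (tagged-unique tag tag-f k (injective ∘ ℕP.m≤n⇒m≤1+n) xs!)
    disjoint
    where
    disjoint : ∀ {y} → ¬ (y ∈ map (f (suc k)) xs × y ∈ tagged k)
    disjoint (y∈map , y∈rest) with ∈-map⁻ (f (suc k)) y∈map | ∈-tagged⁻ k y∈rest
    ... | x , x∈xs , refl | a , x′ , _ , a≤k , x′∈xs , eq =
      ℕP.1+n≰n (subst (ℕ._≤ k) (trans (sym (trans (cong tag eq) (tag-f a x′∈xs))) (tag-f (suc k) x∈xs)) a≤k)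

-- Enumeration of the join-irreducibles

splitPair : ℕ → ℕ → Word n × Word n → Word (suc n) × Word (suc n)
splitPair m₀ a (A , B) = zeros a ++ map suc A , zeros (m₀ ∸ a) ++ map suc B

junctionWord : ℕ → ℕ → Word n × Word n → Word (suc n)
junctionWord m₀ a (A , B) = (zeros a ++ map suc A) ++ zeros (m₀ ∸ a) ++ map suc B

liftedWord : ℕ → Word n → Word (suc n)
liftedWord m₀ w = zeros m₀ ++ map suc w

SortedPair : Vec ℕ n → Word n × Word n → Set
SortedPair m (A , B) = descents A ≡ 0 × descents B ≡ 0 × InBL m (A ++ B)

-- The pairs (A , B) with A ≢ [] and SortedPair m (A , B); the extra pair ([] , sortedWord ms)
-- supplies the case A = [] one level down.
sortedSplits : Vec ℕ n → List (Word n × Word n)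
sortedSplits [] = []
sortedSplits (m₀ ∷ ms) = tagged (splitPair m₀) (([] , sortedWord ms) ∷ sortedSplits ms) m₀

joinIrreducibles : Vec ℕ n → List (Word n)
joinIrreducibles [] = []
joinIrreducibles (m₀ ∷ ms) =
  tagged (junctionWord m₀) (sortedSplits ms) (m₀ ∸ 1) ++ map (liftedWord m₀) (joinIrreducibles ms)

splitCount : Vec ℕ n → ℕ
splitCount [] = 0
splitCount (m₀ ∷ ms) = m₀ ℕ.* suc (splitCount ms)

module _ {n : ℕ} where
  private
    V = Word n
    W = Word (suc n)

  occ-zero-blocks : ∀ a b (A B : V) → occ zero ((zeros a ++ map suc A) ++ zeros b ++ map suc B) ≡ a + b
  occ-zero-blocks a b A B =
    trans (occ-++ zero (zeros a ++ map suc A) _) (cong₂ _+_ (occ-zero-block a A) (occ-zero-block b B))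

  lower-blocks : ∀ a b (A B : V) → lower ((zeros a ++ map suc A) ++ zeros b ++ map suc B) ≡ A ++ B
  lower-blocks a b A B = trans (lower-++ (zeros a ++ map suc A) _) (cong₂ _++_ (lower-block a A) (lower-block b B))

  junction∈BL : ∀ {m₀} {ms : Vec ℕ n} a (A B : V) → 1 ℕ.≤ a → a ℕ.≤ m₀ → InBL ms (A ++ B) →
                InBL (m₀ ∷ ms) (junctionWord m₀ a (A , B))
  junction∈BL {m₀} {ms} (suc a) A B _ a≤m₀ AB∈BL = InBL-∷⁺ (junctionWord m₀ (suc a) (A , B))
    (trans (occ-zero-blocks (suc a) (m₀ ∸ suc a) A B) (ℕP.m+[n∸m]≡n a≤m₀))
    (subst (InBL ms) (sym (lower-blocks (suc a) (m₀ ∸ suc a) A B)) AB∈BL) refl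

  descents-junctionWord : ∀ m₀ a (A B : V) → A ≢ [] → descents A ≡ 0 → descents B ≡ 0 → a ℕ.≤ m₀ →
                          descents (junctionWord (suc m₀) a (A , B)) ≡ 1
  descents-junctionWord m₀ a [] B A≢[] _ _ _ = ⊥-elim (A≢[] refl)
  descents-junctionWord m₀ a (x ∷ A) B _ A-sorted B-sorted a≤m₀ = begin
    descents ((zeros a ++ map suc (x ∷ A)) ++ zeros (suc m₀ ∸ a) ++ map suc B)
      ≡⟨ cong descents (ListP.++-assoc (zeros a) (map suc (x ∷ A)) _) ⟩
    descents (zeros a ++ map suc (x ∷ A) ++ zeros (suc m₀ ∸ a) ++ map suc B)
      ≡⟨ descents-zeros-++ a _ ⟩
    descents (map suc (x ∷ A) ++ zeros (suc m₀ ∸ a) ++ map suc B)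
      ≡⟨ cong (λ k → descents (map suc (x ∷ A) ++ zeros k ++ map suc B)) (ℕP.+-∸-assoc 1 a≤m₀) ⟩
    descents (suc x ∷ map suc A ++ zero ∷ zeros (m₀ ∸ a) ++ map suc B)
      ≡⟨ descents-junction x A (zeros (m₀ ∸ a) ++ map suc B) ⟩
    descents (x ∷ A) + suc (descents (zeros (suc (m₀ ∸ a)) ++ map suc B))
      ≡⟨ cong₂ (λ d e → d + suc e) A-sorted (trans (descents-block (suc (m₀ ∸ a)) B) B-sorted) ⟩
    1 ∎
    where open ≡-Reasoning

sortedSplits-sound : ∀ (m : Vec ℕ n) → Positive m → ∀ {p} → p ∈ sortedSplits m → proj₁ p ≢ [] × SortedPair m p
sortedSplits-sound (m₀ ∷ ms) positive p∈ with ∈-tagged⁻ (splitPair m₀) _ m₀ p∈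
... | suc a , (A , B) , _ , a≤m₀ , q∈ , refl with smaller-pair q∈
  where
  smaller-pair : ∀ {q} → q ∈ ([] , sortedWord ms) ∷ sortedSplits ms → SortedPair ms q
  smaller-pair (here refl) = refl , descents-sortedWord ms , sortedWord∈BL ms (positive ∘ suc)
  smaller-pair (there q∈) = proj₂ (sortedSplits-sound ms (positive ∘ suc) q∈)
...   | A-sorted , B-sorted , AB∈BL =
  (λ ()) , trans (descents-block (suc a) A) A-sorted , trans (descents-block (m₀ ∸ suc a) B) B-sorted ,
  junction∈BL (suc a) A B (s≤s z≤n) a≤m₀ AB∈BL

joinIrreducibles-sound : ∀ (m : Vec ℕ n) → Positive m → ∀ {w} → w ∈ joinIrreducibles m → InBL m w × descents w ≡ 1
joinIrreducibles-sound (zero ∷ ms) positive _ with () ← positive zero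
joinIrreducibles-sound (suc m₀ ∷ ms) positive w∈ with ∈-++⁻ (tagged (junctionWord (suc m₀)) (sortedSplits ms) m₀) w∈
... | inj₁ w∈junctions with ∈-tagged⁻ (junctionWord (suc m₀)) (sortedSplits ms) m₀ w∈junctions
...   | a , (A , B) , 1≤a , a≤m₀ , AB∈ , refl with sortedSplits-sound ms (positive ∘ suc) AB∈
...     | A≢[] , A-sorted , B-sorted , AB∈BL =
  junction∈BL a A B 1≤a (ℕP.m≤n⇒m≤1+n a≤m₀) AB∈BL , descents-junctionWord m₀ a A B A≢[] A-sorted B-sorted a≤m₀
joinIrreducibles-sound (suc m₀ ∷ ms) positive w∈ | inj₂ w∈lifted with ∈-map⁻ (liftedWord (suc m₀)) w∈lifted
... | w , w∈ , refl with joinIrreducibles-sound ms (positive ∘ suc) w∈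
...   | w∈BL , one = InBL-zeros-++ w (positive zero) w∈BL , trans (descents-block (suc m₀) w) one

sortedSplits-complete : ∀ (m : Vec ℕ n) → Positive m → ∀ {A B} → A ≢ [] → SortedPair m (A , B) → (A , B) ∈ sortedSplits m
sortedSplits-complete [] _ {[]} A≢[] _ = ⊥-elim (A≢[] refl)
sortedSplits-complete (m₀ ∷ ms) positive {A} {B} A≢[] (A-sorted , B-sorted , AB∈BL) =
  subst (_∈ sortedSplits (m₀ ∷ ms)) (sym AB≡split)
    (∈-tagged⁺ (splitPair m₀) _ m₀ (zero-in-A A A≢[] starts) a≤m₀ (smaller-pair-complete (lower A) (lower B) lowered))
  where
  a = occ zero A
  b = occ zero B
  zeros-ok = proj₁ (InBL-∷⁻ (A ++ B) AB∈BL)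
  starts = proj₂ (proj₂ (InBL-∷⁻ (A ++ B) AB∈BL))
  a+b≡m₀ : a + b ≡ m₀
  a+b≡m₀ = trans (sym (occ-++ zero A B)) zeros-ok
  a≤m₀ : a ℕ.≤ m₀
  a≤m₀ = subst (a ℕ.≤_) a+b≡m₀ (ℕP.m≤m+n a b)
  zero-in-A : ∀ A → A ≢ [] → StartsWithZero (A ++ B) → 1 ℕ.≤ occ zero A
  zero-in-A [] A≢[] _ = ⊥-elim (A≢[] refl)
  zero-in-A (zero ∷ A) _ _ = s≤s z≤n
  AB≡split : (A , B) ≡ splitPair m₀ a (lower A , lower B)
  AB≡split = cong₂ _,_ (sorted-decomposition A A-sorted)
    (trans (sorted-decomposition B B-sorted)
      (cong (λ k → zeros k ++ map suc (lower B)) (sym (trans (cong (_∸ a) (sym a+b≡m₀)) (ℕP.m+n∸m≡n a b)))))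
  lowered : SortedPair ms (lower A , lower B)
  lowered = sorted-lower A A-sorted , sorted-lower B B-sorted ,
            subst (InBL ms) (lower-++ A B) (proj₁ (proj₂ (InBL-∷⁻ (A ++ B) AB∈BL)))
  smaller-pair-complete : ∀ A′ B′ → SortedPair ms (A′ , B′) → (A′ , B′) ∈ ([] , sortedWord ms) ∷ sortedSplits ms
  smaller-pair-complete [] B′ (_ , B′-sorted , (counts , _)) = here (cong ([] ,_) (sorted-unique ms B′ B′-sorted counts))
  smaller-pair-complete (x ∷ A′) B′ pair = there (sortedSplits-complete ms (positive ∘ suc) (λ ()) pair)

data NonzeroPrefixView : Word (suc n) → Set where
  all-nonzero : ∀ (A : Word n) → NonzeroPrefixView (map suc A)
  then-zero : ∀ (A : Word n) R → NonzeroPrefixView (map suc A ++ zero ∷ R)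

nonzeroPrefixView : ∀ (w : Word (suc n)) → NonzeroPrefixView w
nonzeroPrefixView [] = all-nonzero []
nonzeroPrefixView (zero ∷ R) = then-zero [] R
nonzeroPrefixView (suc x ∷ w) with nonzeroPrefixView w
... | all-nonzero A = all-nonzero (x ∷ A)
... | then-zero A R = then-zero (x ∷ A) R

data BlockView : Word (suc n) → Set where
  lifted : ∀ c (A : Word n) → BlockView (zeros c ++ map suc A)
  junction : ∀ c (A : Word n) R → A ≢ [] → BlockView (zeros c ++ map suc A ++ zero ∷ R)

blockView : ∀ (w : Word (suc n)) → BlockView w
blockView [] = lifted 0 []
blockView (zero ∷ w) with blockView w
... | lifted c A = lifted (suc c) A
... | junction c A R A≢[] = junction (suc c) A R A≢[]
blockView (suc x ∷ w) with nonzeroPrefixView w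
... | all-nonzero A = lifted 0 (x ∷ A)
... | then-zero A R = junction 0 (x ∷ A) R (λ ())

descents-junction-split : ∀ c (A : Word n) R → A ≢ [] → descents (zeros c ++ map suc A ++ zero ∷ R) ≡ 1 →
                          descents A ≡ 0 × descents (zero ∷ R) ≡ 0
descents-junction-split c [] R A≢[] _ = ⊥-elim (A≢[] refl)
descents-junction-split c (x ∷ A) R _ one = ℕP.m+n≡0⇒m≡0 _ sum≡0 , ℕP.m+n≡0⇒n≡0 (descents (x ∷ A)) sum≡0
  where
  sum≡0 : descents (x ∷ A) + descents (zero ∷ R) ≡ 0
  sum≡0 = ℕP.suc-injective (begin
    suc (descents (x ∷ A) + descents (zero ∷ R))    ≡⟨ ℕP.+-suc (descents (x ∷ A)) _ ⟨
    descents (x ∷ A) + suc (descents (zero ∷ R))    ≡⟨ descents-junction x A R ⟨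
    descents (map suc (x ∷ A) ++ zero ∷ R)          ≡⟨ descents-zeros-++ c _ ⟨
    descents (zeros c ++ map suc (x ∷ A) ++ zero ∷ R) ≡⟨ one ⟩
    1                                               ∎)
    where open ≡-Reasoning

module _ {m₀ : ℕ} {ms : Vec ℕ n} (positive : Positive (suc m₀ ∷ ms)) where

  junction-complete : ∀ c (A : Word n) R → A ≢ [] → InBL (suc m₀ ∷ ms) (zeros c ++ map suc A ++ zero ∷ R) →
                      descents (zeros c ++ map suc A ++ zero ∷ R) ≡ 1 →
                      zeros c ++ map suc A ++ zero ∷ R ∈ tagged (junctionWord (suc m₀)) (sortedSplits ms) m₀
  junction-complete c A R A≢[] w∈BL one =
    subst (_∈ tagged (junctionWord (suc m₀)) (sortedSplits ms) m₀) junction≡w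
      (∈-tagged⁺ (junctionWord (suc m₀)) (sortedSplits ms) m₀ (zero-first c A A≢[] starts) c≤m₀
        (sortedSplits-complete ms (positive ∘ suc) A≢[] (A-sorted , B-sorted , AB∈BL)))
    where
    w = zeros c ++ map suc A ++ zero ∷ R
    A-sorted = proj₁ (descents-junction-split c A R A≢[] one)
    tail-sorted = proj₂ (descents-junction-split c A R A≢[] one)
    d = occ zero R
    B = lower R
    w≡blocks : w ≡ (zeros c ++ map suc A) ++ zeros (suc d) ++ map suc B
    w≡blocks = trans (cong (λ t → zeros c ++ map suc A ++ t) (sorted-decomposition (zero ∷ R) tail-sorted))
                     (sym (ListP.++-assoc (zeros c) (map suc A) _))
    zeros-ok = proj₁ (InBL-∷⁻ w w∈BL)
    starts = proj₂ (proj₂ (InBL-∷⁻ w w∈BL))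
    c+1+d≡1+m₀ : c + suc d ≡ suc m₀
    c+1+d≡1+m₀ = trans (sym (occ-zero-blocks c (suc d) A B)) (trans (cong (occ zero) (sym w≡blocks)) zeros-ok)
    c≤m₀ : c ℕ.≤ m₀
    c≤m₀ = subst (c ℕ.≤_) (ℕP.suc-injective (trans (sym (ℕP.+-suc c d)) c+1+d≡1+m₀)) (ℕP.m≤m+n c d)
    zero-first : ∀ c A → A ≢ [] → StartsWithZero (zeros c ++ map suc A ++ zero ∷ R) → 1 ℕ.≤ c
    zero-first zero [] A≢[] _ = ⊥-elim (A≢[] refl)
    zero-first (suc c) _ _ _ = s≤s z≤n
    B-sorted : descents B ≡ 0
    B-sorted = sorted-lower (zero ∷ R) tail-sorted
    AB∈BL : InBL ms (A ++ B)
    AB∈BL = subst (InBL ms) (trans (cong lower w≡blocks) (lower-blocks c (suc d) A B)) (proj₁ (proj₂ (InBL-∷⁻ w w∈BL)))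
    junction≡w : junctionWord (suc m₀) c (A , B) ≡ w
    junction≡w = trans (cong (λ k → (zeros c ++ map suc A) ++ zeros k ++ map suc B)
                         (trans (cong (_∸ c) (sym c+1+d≡1+m₀)) (ℕP.m+n∸m≡n c (suc d))))
                       (sym w≡blocks)

joinIrreducibles-complete : ∀ (m : Vec ℕ n) → Positive m → ∀ w → InBL m w → descents w ≡ 1 → w ∈ joinIrreducibles m
joinIrreducibles-complete [] _ [] _ ()
joinIrreducibles-complete (zero ∷ ms) positive _ _ _ with () ← positive zero
joinIrreducibles-complete (suc m₀ ∷ ms) positive w w∈BL one with blockView w
... | junction c A R A≢[] = ∈-++⁺ˡ (junction-complete positive c A R A≢[] w∈BL one)
... | lifted c A with InBL-∷⁻ (zeros c ++ map suc A) w∈BL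
...   | zeros-ok , lowered∈BL , _ with trans (sym (occ-zero-block c A)) zeros-ok
...     | refl = ∈-++⁺ʳ (tagged (junctionWord (suc m₀)) (sortedSplits ms) m₀) (∈-map⁺ (liftedWord (suc m₀))
                   (joinIrreducibles-complete ms (positive ∘ suc) A (subst (InBL ms) (lower-block c A) lowered∈BL)
                     (trans (sym (descents-block c A)) one)))

leadingZeros : Word (suc n) → ℕ
leadingZeros [] = 0
leadingZeros (zero ∷ w) = suc (leadingZeros w)
leadingZeros (suc _ ∷ _) = 0

module _ {n : ℕ} where
  private
    V = Word n
    W = Word (suc n)

  leadingZeros-block : ∀ a (A : V) → leadingZeros (zeros a ++ map suc A) ≡ a
  leadingZeros-block zero [] = refl
  leadingZeros-block zero (x ∷ A) = refl
  leadingZeros-block (suc a) A = cong suc (leadingZeros-block a A)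

  leadingZeros-block-++ : ∀ a (A : V) (X : W) → A ≢ [] → leadingZeros ((zeros a ++ map suc A) ++ X) ≡ a
  leadingZeros-block-++ zero [] X A≢[] = ⊥-elim (A≢[] refl)
  leadingZeros-block-++ zero (x ∷ A) X _ = refl
  leadingZeros-block-++ (suc a) A X A≢[] = cong suc (leadingZeros-block-++ a A X A≢[])

  map-suc-injective : ∀ {A C : V} → map suc A ≡ map suc C → A ≡ C
  map-suc-injective = ListP.map-injective FinP.suc-injective

  block-injective : ∀ a {A C : V} → zeros a ++ map suc A ≡ zeros a ++ map suc C → A ≡ C
  block-injective a eq = map-suc-injective (ListP.++-cancelˡ (zeros a) _ _ eq)

  map-suc-++-zero-injective : ∀ (A C : V) {X Y : W} → map suc A ++ zero ∷ X ≡ map suc C ++ zero ∷ Y → A ≡ C × X ≡ Y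
  map-suc-++-zero-injective [] [] eq = refl , ListP.∷-injectiveʳ eq
  map-suc-++-zero-injective (a ∷ A) (c ∷ C) eq with ListP.∷-injective eq
  ... | a≡c , eq′ with map-suc-++-zero-injective A C eq′
  ...   | refl , refl = cong (_∷ A) (FinP.suc-injective a≡c) , refl

  splitPair-injective : ∀ m₀ a {p q : V × V} → splitPair m₀ a p ≡ splitPair m₀ a q → p ≡ q
  splitPair-injective m₀ a {A , B} {C , D} eq =
    cong₂ _,_ (block-injective a (cong proj₁ eq)) (block-injective (m₀ ∸ a) (cong proj₂ eq))

  junctionWord-injective : ∀ m₀ a {p q : V × V} → a ℕ.≤ m₀ → junctionWord (suc m₀) a p ≡ junctionWord (suc m₀) a q → p ≡ q
  junctionWord-injective m₀ a {A , B} {C , D} a≤m₀ eq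
    with map-suc-++-zero-injective A C (ListP.++-cancelˡ (zeros a) _ _ (trans (sym (reassociate A B)) (trans eq (reassociate C D))))
    where
    reassociate : ∀ X Y → junctionWord (suc m₀) a (X , Y) ≡ zeros a ++ map suc X ++ zero ∷ zeros (m₀ ∸ a) ++ map suc Y
    reassociate X Y = trans (ListP.++-assoc (zeros a) (map suc X) _)
      (cong (λ k → zeros a ++ map suc X ++ zeros k ++ map suc Y) (ℕP.+-∸-assoc 1 a≤m₀))
  ... | refl , eq′ = cong (A ,_) (block-injective (m₀ ∸ a) eq′)

sortedSplits-unique : ∀ (m : Vec ℕ n) → Positive m → Unique (sortedSplits m)
sortedSplits-unique [] _ = []
sortedSplits-unique (m₀ ∷ ms) positive =
  tagged-unique (splitPair m₀) _ (leadingZeros ∘ proj₁) (λ a {(A , _)} _ → leadingZeros-block a A) m₀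
    (λ _ → splitPair-injective m₀ _) (All.tabulate fresh ∷ sortedSplits-unique ms (positive ∘ suc))
  where
  fresh : ∀ {p} → p ∈ sortedSplits ms → ([] , sortedWord ms) ≢ p
  fresh p∈ eq = proj₁ (sortedSplits-sound ms (positive ∘ suc) p∈) (sym (cong proj₁ eq))

joinIrreducibles-unique : ∀ (m : Vec ℕ n) → Positive m → Unique (joinIrreducibles m)
joinIrreducibles-unique [] _ = []
joinIrreducibles-unique (zero ∷ ms) positive with () ← positive zero
joinIrreducibles-unique (suc m₀ ∷ ms) positive = Unique.++⁺
  (tagged-unique (junctionWord (suc m₀)) (sortedSplits ms) leadingZeros tag m₀
    (λ a≤m₀ → junctionWord-injective m₀ _ a≤m₀) (sortedSplits-unique ms (positive ∘ suc)))
  (Unique.map⁺ (block-injective (suc m₀)) (joinIrreducibles-unique ms (positive ∘ suc)))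
  disjoint
  where
  tag : ∀ a {p} → p ∈ sortedSplits ms → leadingZeros (junctionWord (suc m₀) a p) ≡ a
  tag a {A , B} p∈ = leadingZeros-block-++ a A _ (proj₁ (sortedSplits-sound ms (positive ∘ suc) p∈))
  disjoint : ∀ {w} → ¬ (w ∈ tagged (junctionWord (suc m₀)) (sortedSplits ms) m₀ × w ∈ map (liftedWord (suc m₀)) (joinIrreducibles ms))
  disjoint (w∈junctions , w∈lifted) with ∈-tagged⁻ (junctionWord (suc m₀)) (sortedSplits ms) m₀ w∈junctions | ∈-map⁻ (liftedWord (suc m₀)) w∈lifted
  ... | a , p , _ , a≤m₀ , p∈ , refl | v , _ , eq =
    ℕP.1+n≰n (subst (ℕ._≤ m₀) (trans (sym (tag a p∈)) (trans (cong leadingZeros eq) (leadingZeros-block (suc m₀) v))) a≤m₀)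

length-sortedSplits : ∀ (m : Vec ℕ n) → length (sortedSplits m) ≡ splitCount m
length-sortedSplits [] = refl
length-sortedSplits (m₀ ∷ ms) =
  trans (length-tagged (splitPair m₀) _ m₀) (cong (λ k → m₀ ℕ.* suc k) (length-sortedSplits ms))

length-joinIrreducibles : ∀ (m : Vec ℕ n) → Positive m → length (joinIrreducibles m) + sum (toList m) ≡ splitCount m
length-joinIrreducibles [] _ = refl
length-joinIrreducibles (zero ∷ ms) positive with () ← positive zero
length-joinIrreducibles (suc m₀ ∷ ms) positive = begin
  length (tagged (junctionWord (suc m₀)) (sortedSplits ms) m₀ ++ map (liftedWord (suc m₀)) (joinIrreducibles ms)) + (suc m₀ + s)
    ≡⟨ cong (_+ (suc m₀ + s)) (ListP.length-++ (tagged (junctionWord (suc m₀)) (sortedSplits ms) m₀)) ⟩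
  (length (tagged (junctionWord (suc m₀)) (sortedSplits ms) m₀) + length (map (liftedWord (suc m₀)) (joinIrreducibles ms))) + (suc m₀ + s)
    ≡⟨ cong₂ (λ t l → (t + l) + (suc m₀ + s))
         (trans (length-tagged (junctionWord (suc m₀)) (sortedSplits ms) m₀) (cong (m₀ ℕ.*_) (length-sortedSplits ms)))
         (ListP.length-map (liftedWord (suc m₀)) (joinIrreducibles ms)) ⟩
  (m₀ ℕ.* splitCount ms + j) + (suc m₀ + s)
    ≡⟨ cong (λ k → (m₀ ℕ.* k + j) + (suc m₀ + s)) (sym ih) ⟩
  (m₀ ℕ.* (j + s) + j) + (suc m₀ + s)
    ≡⟨ solve 3 (λ a j s → (a :* (j :+ s) :+ j) :+ (con 1 :+ a :+ s) := (con 1 :+ a) :* (con 1 :+ (j :+ s)))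
         refl m₀ j s ⟩
  suc m₀ ℕ.* suc (j + s)
    ≡⟨ cong (λ k → suc m₀ ℕ.* suc k) ih ⟩
  suc m₀ ℕ.* suc (splitCount ms) ∎
  where
  open ≡-Reasoning
  open ℕSolver using (solve; _:+_; _:*_; _:=_; con)
  j = length (joinIrreducibles ms)
  s = sum (toList ms)
  ih = length-joinIrreducibles ms (positive ∘ suc)

open import Data.Integer using (ℤ; +_)

-- The closed formula

-- formula m unfolds to formulaOf (toList m) (n ∸ 1).
formulaTerm : List ℕ → ℕ → ℤ
formulaTerm ms i = + product (take i ms) ℤ.* (+ product (map suc (drop (suc i) ms)) ℤ.- + 1)

formulaOf : List ℕ → ℕ → ℤ
formulaOf ms k = + product (map suc ms) ℤ.- (+ sum ms ℤ.+ + 1) ℤ.- sumℤ (map (formulaTerm ms) (upTo k))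

sumℤ-applyUpTo-*ˡ : ∀ (c : ℤ) (h : ℕ → ℤ) k → sumℤ (applyUpTo (λ i → c ℤ.* h i) k) ≡ c ℤ.* sumℤ (applyUpTo h k)
sumℤ-applyUpTo-*ˡ c h zero = sym (ℤP.*-zeroʳ c)
sumℤ-applyUpTo-*ˡ c h (suc k) =
  trans (cong (λ z → c ℤ.* h 0 ℤ.+ z) (sumℤ-applyUpTo-*ˡ c (h ∘ suc) k)) (sym (ℤP.*-distribˡ-+ c (h 0) _))

sumℤ-applyUpTo-cong : ∀ {f g : ℕ → ℤ} → (∀ i → f i ≡ g i) → ∀ k → sumℤ (applyUpTo f k) ≡ sumℤ (applyUpTo g k)
sumℤ-applyUpTo-cong f≗g zero = refl
sumℤ-applyUpTo-cong f≗g (suc k) = cong₂ ℤ._+_ (f≗g 0) (sumℤ-applyUpTo-cong (f≗g ∘ suc) k)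

formulaTerm-∷ : ∀ m₀ ms i → formulaTerm (m₀ ∷ ms) (suc i) ≡ + m₀ ℤ.* formulaTerm ms i
formulaTerm-∷ m₀ ms i = trans (cong (ℤ._* _) (ℤP.pos-* m₀ (product (take i ms)))) (ℤP.*-assoc (+ m₀) _ _)

formula≡splitCount-sum : ∀ (m : Vec ℕ n) → formula m ≡ + splitCount m ℤ.- + sum (toList m)
formula≡splitCount-sum [] = refl
formula≡splitCount-sum (m₀ ∷ []) rewrite ℕP.*-identityʳ m₀ | ℕP.+-identityʳ m₀ =
  solve 1 (λ x → (con (+ 1) :+ x) :- (x :+ con (+ 1)) :- con (+ 0) := x :- x) refl (+ m₀)
  where open ℤSolver using (solve; _:+_; _:-_; _:=_; con)
formula≡splitCount-sum {suc (suc k)} (m₀ ∷ xs) = begin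
  formulaOf (m₀ ∷ ms) (suc k)
    ≡⟨ cong (λ z → + (suc m₀ ℕ.* product (map suc ms)) ℤ.- (+ (m₀ + sum ms) ℤ.+ + 1) ℤ.- (+ 1 ℤ.* (Q ℤ.- + 1) ℤ.+ z)) later-terms ⟩
  + (suc m₀ ℕ.* product (map suc ms)) ℤ.- (+ (m₀ + sum ms) ℤ.+ + 1) ℤ.- (+ 1 ℤ.* (Q ℤ.- + 1) ℤ.+ M ℤ.* G)
    ≡⟨ cong₂ (λ a b → a ℤ.- (b ℤ.+ + 1) ℤ.- (+ 1 ℤ.* (Q ℤ.- + 1) ℤ.+ M ℤ.* G))
         (ℤP.pos-* (suc m₀) (product (map suc ms))) (ℤP.pos-+ m₀ (sum ms)) ⟩
  (+ 1 ℤ.+ M) ℤ.* Q ℤ.- ((M ℤ.+ S) ℤ.+ + 1) ℤ.- (+ 1 ℤ.* (Q ℤ.- + 1) ℤ.+ M ℤ.* G)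
    ≡⟨ solve 4 (λ M Q S G → (con (+ 1) :+ M) :* Q :- ((M :+ S) :+ con (+ 1)) :- (con (+ 1) :* (Q :- con (+ 1)) :+ M :* G)
                            := M :* (con (+ 1) :+ ((Q :- (S :+ con (+ 1)) :- G) :+ S)) :- (M :+ S)) refl M Q S G ⟩
  M ℤ.* (+ 1 ℤ.+ ((Q ℤ.- (S ℤ.+ + 1) ℤ.- G) ℤ.+ S)) ℤ.- (M ℤ.+ S)
    ≡⟨ cong (λ z → M ℤ.* (+ 1 ℤ.+ (z ℤ.+ S)) ℤ.- (M ℤ.+ S)) (formula≡splitCount-sum xs) ⟩
  M ℤ.* (+ 1 ℤ.+ ((N ℤ.- S) ℤ.+ S)) ℤ.- (M ℤ.+ S)
    ≡⟨ solve 3 (λ M N S → M :* (con (+ 1) :+ ((N :- S) :+ S)) :- (M :+ S) := M :* (con (+ 1) :+ N) :- (M :+ S)) refl M N S ⟩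
  M ℤ.* (+ 1 ℤ.+ N) ℤ.- (M ℤ.+ S)
    ≡⟨ cong₂ ℤ._-_ (sym (ℤP.pos-* m₀ (suc (splitCount xs)))) (sym (ℤP.pos-+ m₀ (sum ms))) ⟩
  + (m₀ ℕ.* suc (splitCount xs)) ℤ.- + (m₀ + sum ms) ∎
  where
  open ≡-Reasoning
  open ℤSolver using (solve; _:+_; _:-_; _:*_; _:=_; con)
  ms = toList xs
  Q = + product (map suc ms)
  S = + sum ms
  M = + m₀
  N = + splitCount xs
  G = sumℤ (map (formulaTerm ms) (upTo k))
  later-terms : sumℤ (map (formulaTerm (m₀ ∷ ms)) (applyUpTo suc k)) ≡ M ℤ.* G
  later-terms = begin
    sumℤ (map (formulaTerm (m₀ ∷ ms)) (applyUpTo suc k))      ≡⟨ cong sumℤ (ListP.map-applyUpTo suc (formulaTerm (m₀ ∷ ms)) k) ⟩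
    sumℤ (applyUpTo (formulaTerm (m₀ ∷ ms) ∘ suc) k)          ≡⟨ sumℤ-applyUpTo-cong (formulaTerm-∷ m₀ ms) k ⟩
    sumℤ (applyUpTo (λ i → M ℤ.* formulaTerm ms i) k)        ≡⟨ sumℤ-applyUpTo-*ˡ M (formulaTerm ms) k ⟩
    M ℤ.* sumℤ (applyUpTo (formulaTerm ms) k)                ≡⟨ cong (λ l → M ℤ.* sumℤ l) (ListP.map-applyUpTo (λ i → i) (formulaTerm ms) k) ⟨
    M ℤ.* G                                                  ∎

∈joinIrreducibles⇔JoinIrreducible : ∀ (m : Vec ℕ n) → Positive m → ∀ w → (w ∈ joinIrreducibles m ⇔ JoinIrreducible m w)
∈joinIrreducibles⇔JoinIrreducible m positive w = mk⇔
  (λ w∈ → let w∈BL , one = joinIrreducibles-sound m positive w∈ in descents≡1⇒JoinIrreducible {m = m} w w∈BL one)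
  (λ irreducible → joinIrreducibles-complete m positive w (proj₁ irreducible) (JoinIrreducible⇒descents≡1 {m = m} w irreducible))

theorem3p4 : (n : ℕ) (m : Vec ℕ n) → (∀ (i : Fin n) → 1 ≤ lookup m i) →
    ∃[ L ] (Unique L × (∀ (w : List (Fin n)) → (w ∈ L ⇔ JoinIrreducible m w)) ×
      (+ length L) ≡ formula m)
theorem3p4 n m positive =
  joinIrreducibles m , joinIrreducibles-unique m positive , ∈joinIrreducibles⇔JoinIrreducible m positive , count
  where
  L = length (joinIrreducibles m)
  s = sum (toList m)
  count : + L ≡ formula m
  count = sym (begin
    formula m                     ≡⟨ formula≡splitCount-sum m ⟩
    + splitCount m ℤ.- + s        ≡⟨ cong (λ k → + k ℤ.- + s) (length-joinIrreducibles m positive) ⟨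
    + (L + s) ℤ.- + s             ≡⟨ cong (ℤ._- + s) (ℤP.pos-+ L s) ⟩
    (+ L ℤ.+ + s) ℤ.- + s         ≡⟨ solve 2 (λ l s → (l :+ s) :- s := l) refl (+ L) (+ s) ⟩
    + L                           ∎)
    where
    open ≡-Reasoning
    open ℤSolver using (solve; _:+_; _:-_; _:=_)
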